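{- Let $\Theta_1$ and $\Theta_2$ be closed IIMLL proof nets with the same positive conclusion and an order greater than 3 such that $\Theta_1 \neq \Theta_2$. Then there is a one-hole context $C[]$ such that $C[\Theta_1] \neq C[\Theta_2]$ and both $C[\Theta_1]$ and $C[\Theta_2]$ have an order less than 4.
   Context: IMLL formulas are built from one atom $p$ with $\otimes$ and $⅋$ (par), with polarities; $(A\otimes B)^-$ and $(A⅋B)^+$ are written as linear implications $A \multimap B$. IIMLL proof nets are IMLL proof nets built without $\otimes^+$- and $⅋^-$-links (implicational fragment). Nets are identified with their normal forms (cut elimination plus multiplicative $\eta$-expansion); closed means exactly one conclusion. Order: $\mathrm{order}(p)=1$, $\mathrm{order}(A_1 \multimap \cdots \multimap A_n \multimap p) = \max_i \mathrm{order}(A_i)+1$; the order of a closed net is that of its conclusion. Equality $=$ of normal nets is the paper's equality via main paths, heads and direct subproof nets (corresponding to $\beta\eta$-equality of linear $\lambda$-terms up to renaming of free variables). A one-hole context $C[]$ is an extended IIMLL proof net with exactly one hole axiom of positive conclusion $A^+$; $C[\Theta]$ plugs $\Theta$ into the hole. -}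

module Defs where

open import Data.Nat using (ℕ; zero; suc; _+_; _⊔_; _<ᵇ_; _≡ᵇ_; pred)
open import Data.Bool using (if_then_else_)
open import Data.List using (List; []; _∷_)
open import Data.Product using (Σ; _×_; proj₁)
open import Relation.Binary.PropositionalEquality using (_≡_)

-- IIMLL formulas: one atom p and linear implication.
-- (The positive formula (A ⅋ B)^+ is written A ⊸ B; the implicational
-- fragment only has p and ⊸.)

infixr 30 _⊸_
data Ty : Set where
  p   : Ty
  _⊸_ : Ty → Ty → Ty

-- order(p) = 1 ;  order(A₁ ⊸ ⋯ ⊸ Aₙ ⊸ p) = max_i order(Aᵢ) + 1.
-- Written recursively on the right spine:
--   order (A ⊸ B) = max (order A + 1) (order B).
order : Ty → ℕ
order p       = 1
order (A ⊸ B) = suc (order A) ⊔ order B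

-- IIMLL proof nets, via the Curry–Howard correspondence, are linear
-- λ-terms (de Bruijn indices), identified up to βη-equality.

data Tm : Set where
  var : ℕ → Tm
  lam : Tm → Tm
  app : Tm → Tm → Tm

data _∋_∶_ : List Ty → ℕ → Ty → Set where
  here  : ∀ {Γ A} → (A ∷ Γ) ∋ zero ∶ A
  there : ∀ {Γ A B n} → Γ ∋ n ∶ A → (B ∷ Γ) ∋ suc n ∶ A

data _⊢_∶_ : List Ty → Tm → Ty → Set where
  var : ∀ {Γ n A} → Γ ∋ n ∶ A → Γ ⊢ var n ∶ A
  lam : ∀ {Γ t A B} → (A ∷ Γ) ⊢ t ∶ B → Γ ⊢ lam t ∶ (A ⊸ B)
  app : ∀ {Γ t u A B} → Γ ⊢ t ∶ (A ⊸ B) → Γ ⊢ u ∶ A → Γ ⊢ app t u ∶ B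

occ : ℕ → Tm → ℕ
occ n (var m)   = if m ≡ᵇ n then 1 else 0
occ n (lam t)   = occ (suc n) t
occ n (app t u) = occ n t + occ n u

data Linear : Tm → Set where
  var : ∀ {n} → Linear (var n)
  lam : ∀ {t} → occ zero t ≡ 1 → Linear t → Linear (lam t)
  app : ∀ {t u} → Linear t → Linear u → Linear (app t u)

Net : Ty → Set
Net A = Σ Tm (λ t → ([] ⊢ t ∶ A) × Linear t)

-- one-hole context: exactly one hole (free variable 0) of type A,
-- used exactly once, and otherwise closed, with conclusion B
Context : Ty → Ty → Set
Context A B = Σ Tm (λ c → ((A ∷ []) ⊢ c ∶ B) × Linear c × (occ zero c ≡ 1))

shift : ℕ → Tm → Tm
shift c (var n)   = if n <ᵇ c then var n else var (suc n)
shift c (lam t)   = lam (shift (suc c) t)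
shift c (app t u) = app (shift c t) (shift c u)

subst : ℕ → Tm → Tm → Tm
subst j s (var n)   =
  if n ≡ᵇ j then s else (if n <ᵇ j then var n else var (pred n))
subst j s (lam t)   = lam (subst (suc j) (shift zero s) t)
subst j s (app t u) = app (subst j s t) (subst j s u)

infix 4 _=βη_
data _=βη_ : Tm → Tm → Set where
  β      : ∀ {t u} → app (lam t) u =βη subst zero u t
  η      : ∀ {t} → lam (app (shift zero t) (var zero)) =βη t
  refl   : ∀ {t} → t =βη t
  sym    : ∀ {t u} → t =βη u → u =βη t
  trans  : ∀ {t u v} → t =βη u → u =βη v → t =βη v
  lam    : ∀ {t t'} → t =βη t' → lam t =βη lam t'
  app    : ∀ {t t' u u'} → t =βη t' → u =βη u' → app t u =βη app t' u'

plug : ∀ {A B} → Context A B → Net A → Tm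
plug C Θ = subst zero (proj₁ Θ) (proj₁ C)

-- A closed linear term of type A has an η-long β-normal form, and this normal form is
-- determined by its observation tree: every head variable is recorded by the position of
-- its binder (the path of argument slots and binder indices that leads to it) and its
-- arguments become the children. Linearity makes these positions unique, so the tree
-- determines the term.
--
-- The context C = λ y₁ … yₙ. [] G₁ … Gₘ applies the hole to η-expanded arguments whose heads
-- are fresh variables yᵢ of type p ⊸ ⋯ ⊸ p, one per binder of A, so C has order at most 3.
-- Substituting for the yᵢ untyped terms that build Church-encoded nodes turns C[t] into
-- the encoding of the observation tree of t. If t₁ ≠ t₂, their trees differ at a node
-- reached along a common path; projecting along that path and reading the label of the
-- node as a Church boolean makes C[t₁] and C[t₂] return t₁ and t₂ respectively, so
-- C[t₁] = C[t₂] would force t₁ = t₂.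

module Submission where

open import Defs
open import Data.Nat using (ℕ; zero; suc; _+_; _∸_; _*_; _<_; _≤_; _⊔_; _<ᵇ_; _≡ᵇ_; pred; z≤n; s≤s)
open import Data.Nat.Properties
  using ( _≟_; <-cmp; ≤-refl; ≤-reflexive; ≤-trans; <-trans; <-≤-trans; <-irrefl; <⇒≤; <⇒≢; >⇒≢; <⇒≱; ≤-pred
        ; n≤1+n; n<1+n; m≤n⇒m≤1+n; m<n⇒m<1+n; n≤0⇒n≡0; m≤m+n; m≤n+m; m<m+n; m∸n≤m; m+n≤o⇒m≤o; m+n≤o⇒n≤o
        ; +-assoc; +-comm; +-suc; +-identityʳ; *-zeroʳ; +-mono-≤; +-monoʳ-≤; m+n≡0⇒m≡0; m+n≡0⇒n≡0; ⊔-lub)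
open import Data.Nat.ListAction using (sum)
open import Data.Nat.Tactic.RingSolver using (solve-∀)
open import Data.Bool using (true; false; if_then_else_)
open import Data.List using (List; []; _∷_; _++_; length; map; reverse; [_])
open import Data.List.Properties
  using ( length-++; length-map; length-reverse; ∷-injective; ∷-injectiveʳ; ++-assoc; ++-identityʳ; ++-identityˡ-unique
        ; map-∘; map-id-local; reverse-map; reverse-involutive; unfold-reverse)
import Data.List.Properties as Listₚ
open import Data.List.Relation.Unary.All using (All; []; _∷_)
import Data.List.Relation.Unary.All as All
open import Data.List.Relation.Unary.All.Properties using (++⁺; map⁺)
open import Data.List.Relation.Binary.Pointwise using (Pointwise; []; _∷_)
open import Data.Product using (Σ; _×_; _,_; proj₁; proj₂; uncurry; ∃-syntax)
import Data.Product.Properties as Productₚ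
open import Data.Sum using (_⊎_; inj₁; inj₂)
open import Data.Empty using (⊥-elim)
open import Relation.Nullary using (¬_; yes; no)
open import Relation.Binary using (Setoid; DecidableEquality; tri<; tri≈; tri>)
open import Relation.Binary.PropositionalEquality as ≡ using (_≡_; _≢_; refl; cong; cong₂)
import Relation.Binary.Reasoning.Setoid as SetoidReasoning

<⇒<ᵇ≡true : ∀ {m n} → m < n → (m <ᵇ n) ≡ true
<⇒<ᵇ≡true {zero} {suc n} _ = refl
<⇒<ᵇ≡true {suc m} {suc n} (s≤s m<n) = <⇒<ᵇ≡true m<n

≥⇒<ᵇ≡false : ∀ {m n} → n ≤ m → (m <ᵇ n) ≡ false
≥⇒<ᵇ≡false {m} {zero} _ = refl
≥⇒<ᵇ≡false {suc m} {suc n} (s≤s n≤m) = ≥⇒<ᵇ≡false n≤m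

≡ᵇ-refl : ∀ m → (m ≡ᵇ m) ≡ true
≡ᵇ-refl zero = refl
≡ᵇ-refl (suc m) = ≡ᵇ-refl m

≢⇒≡ᵇ≡false : ∀ {m n} → m ≢ n → (m ≡ᵇ n) ≡ false
≢⇒≡ᵇ≡false {zero} {zero} m≢n = ⊥-elim (m≢n refl)
≢⇒≡ᵇ≡false {zero} {suc n} _ = refl
≢⇒≡ᵇ≡false {suc m} {zero} _ = refl
≢⇒≡ᵇ≡false {suc m} {suc n} m≢n = ≢⇒≡ᵇ≡false (λ m≡n → m≢n (cong suc m≡n))

shift-var< : ∀ {c n} → n < c → shift c (var n) ≡ var n
shift-var< n<c rewrite <⇒<ᵇ≡true n<c = refl

shift-var≥ : ∀ {c n} → c ≤ n → shift c (var n) ≡ var (suc n)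
shift-var≥ {c} {n} c≤n rewrite ≥⇒<ᵇ≡false {n} {c} c≤n = refl

subst-var< : ∀ {j n s} → n < j → subst j s (var n) ≡ var n
subst-var< n<j rewrite ≢⇒≡ᵇ≡false (<⇒≢ n<j) | <⇒<ᵇ≡true n<j = refl

subst-var≡ : ∀ {j s} → subst j s (var j) ≡ s
subst-var≡ {j} rewrite ≡ᵇ-refl j = refl

subst-var> : ∀ {j n s} → j < n → subst j s (var n) ≡ var (pred n)
subst-var> {j} {n} j<n rewrite ≢⇒≡ᵇ≡false (>⇒≢ j<n) | ≥⇒<ᵇ≡false {n} {j} (<⇒≤ j<n) = refl

occ-var≡ : ∀ n → occ n (var n) ≡ 1
occ-var≡ n rewrite ≡ᵇ-refl n = refl

occ-var≢ : ∀ {m n} → m ≢ n → occ n (var m) ≡ 0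
occ-var≢ m≢n rewrite ≢⇒≡ᵇ≡false m≢n = refl

shiftIdx : ℕ → ℕ → ℕ
shiftIdx c n = if n <ᵇ c then n else suc n

shift-var : ∀ c n → shift c (var n) ≡ var (shiftIdx c n)
shift-var c n with n <ᵇ c
... | true = refl
... | false = refl

shiftIdx-suc : ∀ c n → shiftIdx (suc c) (suc n) ≡ suc (shiftIdx c n)
shiftIdx-suc c n with n <ᵇ c
... | true = refl
... | false = refl

data Lookup {A : Set} : List A → ℕ → A → Set where
  here  : ∀ {x xs} → Lookup (x ∷ xs) zero x
  there : ∀ {x y xs n} → Lookup xs n x → Lookup (y ∷ xs) (suc n) x

Lookup-map : ∀ {A B : Set} (f : A → B) {xs n x} → Lookup xs n x → Lookup (map f xs) n (f x)
Lookup-map f here = here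
Lookup-map f (there l) = there (Lookup-map f l)

Lookup-All : ∀ {A : Set} {P : A → Set} {xs n x} → All P xs → Lookup xs n x → P x
Lookup-All (px ∷ _) here = px
Lookup-All (_ ∷ pxs) (there l) = Lookup-All pxs l

Lookup-++ˡ : ∀ {A : Set} {xs ys : List A} {n x} → Lookup xs n x → Lookup (xs ++ ys) n x
Lookup-++ˡ here = here
Lookup-++ˡ (there l) = there (Lookup-++ˡ l)

Lookup-++ʳ : ∀ {A : Set} (xs : List A) {ys n y} → Lookup ys n y → Lookup (xs ++ ys) (length xs + n) y
Lookup-++ʳ [] l = l
Lookup-++ʳ (_ ∷ xs) l = there (Lookup-++ʳ xs l)

Lookup-++-∷ : ∀ {A : Set} (xs : List A) {y ys} → Lookup (xs ++ y ∷ ys) (length xs) y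
Lookup-++-∷ [] = here
Lookup-++-∷ (_ ∷ xs) = there (Lookup-++-∷ xs)

Lookup-reverse : ∀ {A : Set} {xs : List A} {n x} → Lookup xs n x → Lookup (reverse xs) (length xs ∸ suc n) x
Lookup-reverse {xs = x ∷ xs} here
  rewrite unfold-reverse x xs | ≡.sym (length-reverse xs) = Lookup-++-∷ (reverse xs)
Lookup-reverse {xs = y ∷ xs} (there l) rewrite unfold-reverse y xs = Lookup-++ˡ (Lookup-reverse l)

Lookup⇒< : ∀ {A : Set} {xs : List A} {i x} → Lookup xs i x → i < length xs
Lookup⇒< here = s≤s z≤n
Lookup⇒< (there l) = s≤s (Lookup⇒< l)

All-reverse : ∀ {A : Set} {P : A → Set} {xs} → All P xs → All P (reverse xs)
All-reverse [] = []
All-reverse {xs = x ∷ xs} (px ∷ pxs) rewrite unfold-reverse x xs = ++⁺ (All-reverse pxs) (px ∷ [])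

≡⇒βη : ∀ {t u} → t ≡ u → t =βη u
≡⇒βη refl = refl

βη-setoid : Setoid _ _
βη-setoid = record
  { Carrier = Tm ; _≈_ = _=βη_
  ; isEquivalence = record { refl = refl ; sym = sym ; trans = trans } }

module βη-Reasoning = SetoidReasoning βη-setoid

apps : Tm → List Tm → Tm
apps t [] = t
apps t (u ∷ us) = apps (app t u) us

lams : ℕ → Tm → Tm
lams zero t = t
lams (suc n) t = lam (lams n t)

apps-++ : ∀ t us vs → apps t (us ++ vs) ≡ apps (apps t us) vs
apps-++ t [] vs = refl
apps-++ t (u ∷ us) vs = apps-++ (app t u) us vs

apps-congˡ : ∀ {t t′} us → t =βη t′ → apps t us =βη apps t′ us
apps-congˡ [] t=t′ = t=t′
apps-congˡ (u ∷ us) t=t′ = apps-congˡ us (app t=t′ refl)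

apps-cong : ∀ {t t′ us us′} → t =βη t′ → Pointwise _=βη_ us us′ → apps t us =βη apps t′ us′
apps-cong t=t′ [] = t=t′
apps-cong t=t′ (u=u′ ∷ us=us′) = apps-cong (app t=t′ u=u′) us=us′

data Scoped (k : ℕ) : Tm → Set where
  var : ∀ {n} → n < k → Scoped k (var n)
  lam : ∀ {t} → Scoped (suc k) t → Scoped k (lam t)
  app : ∀ {t u} → Scoped k t → Scoped k u → Scoped k (app t u)

Closed : Tm → Set
Closed = Scoped 0

Scoped-weaken : ∀ {k k′ t} → k ≤ k′ → Scoped k t → Scoped k′ t
Scoped-weaken k≤k′ (var n<k) = var (<-≤-trans n<k k≤k′)
Scoped-weaken k≤k′ (lam t) = lam (Scoped-weaken (s≤s k≤k′) t)
Scoped-weaken k≤k′ (app t u) = app (Scoped-weaken k≤k′ t) (Scoped-weaken k≤k′ u)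

Closed⇒Scoped : ∀ {k t} → Closed t → Scoped k t
Closed⇒Scoped = Scoped-weaken z≤n

Scoped-apps : ∀ {k t us} → Scoped k t → All (Scoped k) us → Scoped k (apps t us)
Scoped-apps t [] = t
Scoped-apps t (u ∷ us) = Scoped-apps (app t u) us

Scoped-lams : ∀ n {k t} → Scoped (n + k) t → Scoped k (lams n t)
Scoped-lams zero t = t
Scoped-lams (suc n) {k} {t} sc = lam (Scoped-lams n (≡.subst (λ m → Scoped m t) (≡.sym (+-suc n k)) sc))

shift-scoped : ∀ {k c t} → k ≤ c → Scoped k t → shift c t ≡ t
shift-scoped k≤c (var n<k) = shift-var< (<-≤-trans n<k k≤c)
shift-scoped k≤c (lam t) = cong lam (shift-scoped (s≤s k≤c) t)
shift-scoped k≤c (app t u) = cong₂ app (shift-scoped k≤c t) (shift-scoped k≤c u)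

shift-closed : ∀ {s} → Closed s → shift 0 s ≡ s
shift-closed = shift-scoped z≤n

subst-scoped : ∀ {k j s t} → k ≤ j → Scoped k t → subst j s t ≡ t
subst-scoped k≤j (var n<k) = subst-var< (<-≤-trans n<k k≤j)
subst-scoped k≤j (lam t) = cong lam (subst-scoped (s≤s k≤j) t)
subst-scoped k≤j (app t u) = cong₂ app (subst-scoped k≤j t) (subst-scoped k≤j u)

subst-closed : ∀ {j s t} → Closed t → subst j s t ≡ t
subst-closed = subst-scoped z≤n

subst-apps : ∀ j s t us → subst j s (apps t us) ≡ apps (subst j s t) (map (subst j s) us)
subst-apps j s t [] = refl
subst-apps j s t (u ∷ us) = subst-apps j s (app t u) us

subst-lams : ∀ {s} n j t → Closed s → subst j s (lams n t) ≡ lams n (subst (n + j) s t)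
subst-lams zero j t cs = refl
subst-lams (suc n) j t cs rewrite shift-closed cs | subst-lams n (suc j) t cs | +-suc n j = refl

subst-Scoped : ∀ {d s t} → Closed s → Scoped (suc d) t → Scoped d (subst d s t)
subst-Scoped {d} {s} cs (var {n} n<) with <-cmp n d
... | tri< n<d _ _ rewrite subst-var< {s = s} n<d = var n<d
... | tri≈ _ refl _ rewrite subst-var≡ {n} {s} = Closed⇒Scoped cs
... | tri> _ _ d<n = ⊥-elim (<⇒≱ d<n (≤-pred n<))
subst-Scoped {s = s} cs (lam t) rewrite shift-closed cs = lam (subst-Scoped cs t)
subst-Scoped cs (app t u) = app (subst-Scoped cs t) (subst-Scoped cs u)

-- For closed σ, substs d σ t replaces each variable d + i of t by σᵢ (and lowers the
-- variables beyond).
substs : ℕ → List Tm → Tm → Tm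
substs d [] t = t
substs d (s ∷ σ) t = subst d s (substs (suc d) σ t)

substs-++ : ∀ d σ τ t → substs d (σ ++ τ) t ≡ substs d σ (substs (length σ + d) τ t)
substs-++ d [] τ t = refl
substs-++ d (s ∷ σ) τ t rewrite substs-++ (suc d) σ τ t | +-suc (length σ) d = refl

substs-scoped : ∀ {d σ t} → Scoped d t → substs d σ t ≡ t
substs-scoped {σ = []} sc = refl
substs-scoped {d} {s ∷ σ} {t} sc rewrite substs-scoped {σ = σ} (Scoped-weaken (m≤n⇒m≤1+n ≤-refl) sc)
  = subst-scoped ≤-refl sc

substs-var : ∀ {d σ m s} → All Closed σ → Lookup σ m s → substs d σ (var (d + m)) ≡ s
substs-var {d} {s ∷ σ} (cs ∷ cσ) here
  rewrite +-identityʳ d | substs-scoped {suc d} {σ} {var d} (var (n<1+n d)) = subst-var≡ {d}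
substs-var {d} {_ ∷ σ} {suc m} {s} (_ ∷ cσ) (there l)
  rewrite +-suc d m | substs-var {suc d} cσ l = subst-closed (Lookup-All cσ l)

substs-lam : ∀ {d σ} t → All Closed σ → substs d σ (lam t) ≡ lam (substs (suc d) σ t)
substs-lam t [] = refl
substs-lam {d} {s ∷ σ} t (cs ∷ cσ) rewrite substs-lam {suc d} t cσ | shift-closed cs = refl

substs-app : ∀ {d} σ t u → substs d σ (app t u) ≡ app (substs d σ t) (substs d σ u)
substs-app [] t u = refl
substs-app {d} (s ∷ σ) t u rewrite substs-app {suc d} σ t u = refl

substs-apps : ∀ {d} σ t us → substs d σ (apps t us) ≡ apps (substs d σ t) (map (substs d σ) us)
substs-apps σ t [] = refl
substs-apps {d} σ t (u ∷ us) rewrite substs-apps {d} σ (app t u) us | substs-app {d} σ t u = refl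

substs-lams : ∀ {d σ} n t → All Closed σ → substs d σ (lams n t) ≡ lams n (substs (n + d) σ t)
substs-lams zero t cσ = refl
substs-lams {d} {σ} (suc n) t cσ = ≡.trans (substs-lam (lams n t) cσ)
  (cong lam (≡.trans (substs-lams n t cσ) (cong (λ k → lams n (substs k σ t)) (+-suc n d))))

lams-β : ∀ {as} X → All Closed as → apps (lams (length as) X) as =βη substs 0 (reverse as) X
lams-β X [] = refl
lams-β {a ∷ as} X (ca ∷ cas) = begin
  apps (app (lam (lams (length as) X)) a) as
    ≈⟨ apps-congˡ as β ⟩
  apps (subst 0 a (lams (length as) X)) as
    ≡⟨ cong (λ t → apps t as) (subst-lams (length as) 0 X ca) ⟩
  apps (lams (length as) (subst (length as + 0) a X)) as
    ≈⟨ lams-β _ cas ⟩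
  substs 0 (reverse as) (subst (length as + 0) a X)
    ≡⟨ cong (λ n → substs 0 (reverse as) (subst (n + 0) a X)) (≡.sym (length-reverse as)) ⟩
  substs 0 (reverse as) (substs (length (reverse as) + 0) [ a ] X)
    ≡⟨ ≡.sym (substs-++ 0 (reverse as) [ a ] X) ⟩
  substs 0 (reverse as ++ [ a ]) X
    ≡⟨ cong (λ σ → substs 0 σ X) (≡.sym (unfold-reverse a as)) ⟩
  substs 0 (reverse (a ∷ as)) X ∎
  where open βη-Reasoning

substs-Scoped : ∀ {d σ t} → All Closed σ → Scoped (d + length σ) t → Scoped d (substs d σ t)
substs-Scoped {d} {[]} {t} [] sc = ≡.subst (λ k → Scoped k t) (+-identityʳ d) sc
substs-Scoped {d} {s ∷ σ} {t} (cs ∷ cσ) sc =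
  subst-Scoped cs (substs-Scoped cσ (≡.subst (λ k → Scoped k t) (+-suc d (length σ)) sc))

vars : ℕ → ℕ → List Tm
vars d zero = []
vars d (suc k) = var d ∷ vars (suc d) k

vars-Scoped : ∀ d k → All (Scoped (d + k)) (vars d k)
vars-Scoped d zero = []
vars-Scoped d (suc k) = var (m<m+n d (s≤s z≤n))
  ∷ ≡.subst (λ n → All (Scoped n) (vars (suc d) k)) (≡.sym (+-suc d k)) (vars-Scoped (suc d) k)

map-subst-closed : ∀ {j s us} → All Closed us → map (subst j s) us ≡ us
map-subst-closed cus = map-id-local (All.map subst-closed cus)

substs-vars : ∀ {d σ} → All Closed σ → map (substs d σ) (vars d (length σ)) ≡ σ
substs-vars [] = refl
substs-vars {d} {s ∷ σ} (cs ∷ cσ) = cong₂ _∷_ head tail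
  where
  head : subst d s (substs (suc d) σ (var d)) ≡ s
  head rewrite substs-scoped {suc d} {σ} {var d} (var (n<1+n d)) = subst-var≡ {d}
  tail : map (substs d (s ∷ σ)) (vars (suc d) (length σ)) ≡ σ
  tail = ≡.trans (map-∘ (vars (suc d) (length σ)))
           (≡.trans (cong (map (subst d s)) (substs-vars cσ)) (map-subst-closed cσ))

substs-reverse-vars : ∀ {d bs} → All Closed bs → map (substs d (reverse bs)) (reverse (vars d (length bs))) ≡ bs
substs-reverse-vars {d} {bs} cbs = begin
  map (substs d (reverse bs)) (reverse (vars d (length bs)))
    ≡⟨ reverse-map _ (vars d (length bs)) ⟩
  reverse (map (substs d (reverse bs)) (vars d (length bs)))
    ≡⟨ cong (λ k → reverse (map (substs d (reverse bs)) (vars d k))) (≡.sym (length-reverse bs)) ⟩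
  reverse (map (substs d (reverse bs)) (vars d (length (reverse bs))))
    ≡⟨ cong reverse (substs-vars (All-reverse cbs)) ⟩
  reverse (reverse bs)
    ≡⟨ reverse-involutive bs ⟩
  bs ∎
  where open ≡.≡-Reasoning

map-substs-closed : ∀ {d σ us} → All Closed us → map (substs d σ) us ≡ us
map-substs-closed {d} {σ} cus = map-id-local (All.map (λ c → substs-scoped {d} {σ} (Closed⇒Scoped c)) cus)

∋⇒< : ∀ {Γ n T} → Γ ∋ n ∶ T → n < length Γ
∋⇒< here = s≤s z≤n
∋⇒< (there x) = s≤s (∋⇒< x)

⊢⇒Scoped : ∀ {Γ t T} → Γ ⊢ t ∶ T → Scoped (length Γ) t
⊢⇒Scoped (var x) = var (∋⇒< x)
⊢⇒Scoped (lam ⊢t) = lam (⊢⇒Scoped ⊢t)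
⊢⇒Scoped (app ⊢t ⊢u) = app (⊢⇒Scoped ⊢t) (⊢⇒Scoped ⊢u)

∋-functional : ∀ {Γ n T U} → Γ ∋ n ∶ T → Γ ∋ n ∶ U → T ≡ U
∋-functional here here = refl
∋-functional (there x) (there y) = ∋-functional x y

∋-weaken : ∀ Γ₁ {Γ₂ A n T} → (Γ₁ ++ Γ₂) ∋ n ∶ T → (Γ₁ ++ A ∷ Γ₂) ∋ shiftIdx (length Γ₁) n ∶ T
∋-weaken [] x = there x
∋-weaken (B ∷ Γ₁) here = here
∋-weaken (B ∷ Γ₁) (there {n = n} x) rewrite shiftIdx-suc (length Γ₁) n = there (∋-weaken Γ₁ x)

⊢-weaken : ∀ Γ₁ {Γ₂ A t T} → (Γ₁ ++ Γ₂) ⊢ t ∶ T → (Γ₁ ++ A ∷ Γ₂) ⊢ shift (length Γ₁) t ∶ T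
⊢-weaken Γ₁ (var {n = n} x) rewrite shift-var (length Γ₁) n = var (∋-weaken Γ₁ x)
⊢-weaken Γ₁ (lam {A = B} ⊢t) = lam (⊢-weaken (B ∷ Γ₁) ⊢t)
⊢-weaken Γ₁ (app ⊢t ⊢u) = app (⊢-weaken Γ₁ ⊢t) (⊢-weaken Γ₁ ⊢u)

∋-strengthen< : ∀ Γ₁ {Γ₂ A n T} → (Γ₁ ++ A ∷ Γ₂) ∋ n ∶ T → n < length Γ₁ → (Γ₁ ++ Γ₂) ∋ n ∶ T
∋-strengthen< (B ∷ Γ₁) here _ = here
∋-strengthen< (B ∷ Γ₁) (there x) (s≤s n<) = there (∋-strengthen< Γ₁ x n<)

∋-middle : ∀ Γ₁ {Γ₂ A T} → (Γ₁ ++ A ∷ Γ₂) ∋ length Γ₁ ∶ T → T ≡ A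
∋-middle [] here = refl
∋-middle (B ∷ Γ₁) (there x) = ∋-middle Γ₁ x

∋-strengthen> : ∀ Γ₁ {Γ₂ A n T} → (Γ₁ ++ A ∷ Γ₂) ∋ suc n ∶ T → length Γ₁ ≤ n
  → (Γ₁ ++ Γ₂) ∋ n ∶ T
∋-strengthen> [] (there x) _ = x
∋-strengthen> (B ∷ Γ₁) (there {n = suc n} x) (s≤s ≤n) = there (∋-strengthen> Γ₁ x ≤n)

⊢-subst : ∀ Γ₁ {Γ₂ A s t T} → (Γ₁ ++ A ∷ Γ₂) ⊢ t ∶ T → (Γ₁ ++ Γ₂) ⊢ s ∶ A
  → (Γ₁ ++ Γ₂) ⊢ subst (length Γ₁) s t ∶ T
⊢-subst Γ₁ {s = s} (var {n = n} x) ⊢s with <-cmp n (length Γ₁)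
... | tri< n< _ _ rewrite subst-var< {s = s} n< = var (∋-strengthen< Γ₁ x n<)
... | tri≈ _ refl _ rewrite subst-var≡ {n} {s} | ∋-middle Γ₁ x = ⊢s
⊢-subst Γ₁ {s = s} (var {n = suc n} x) ⊢s | tri> _ _ >n
  rewrite subst-var> {s = s} >n = var (∋-strengthen> Γ₁ x (≤-pred >n))
⊢-subst Γ₁ (lam {A = B} ⊢t) ⊢s = lam (⊢-subst (B ∷ Γ₁) ⊢t (⊢-weaken [] ⊢s))
⊢-subst Γ₁ (app ⊢t ⊢u) ⊢s = app (⊢-subst Γ₁ ⊢t ⊢s) (⊢-subst Γ₁ ⊢u ⊢s)

occ-shift< : ∀ {c k} t → k < c → occ k (shift c t) ≡ occ k t
occ-shift< {c} {k} (var n) k<c with <-cmp n c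
... | tri< n<c _ _ rewrite shift-var< n<c = refl
... | tri≈ _ refl _ rewrite shift-var≥ {n} ≤-refl | occ-var≢ (>⇒≢ (m<n⇒m<1+n k<c)) | occ-var≢ (>⇒≢ k<c) = refl
... | tri> _ _ c<n rewrite shift-var≥ (<⇒≤ c<n)
    | occ-var≢ (>⇒≢ (m<n⇒m<1+n (<-trans k<c c<n))) | occ-var≢ (>⇒≢ (<-trans k<c c<n)) = refl
occ-shift< (lam t) k<c = occ-shift< t (s≤s k<c)
occ-shift< (app t u) k<c = cong₂ _+_ (occ-shift< t k<c) (occ-shift< u k<c)

occ-shift≥ : ∀ {c k} t → c ≤ k → occ (suc k) (shift c t) ≡ occ k t
occ-shift≥ {c} {k} (var n) c≤k with <-cmp n c
... | tri< n<c _ _ rewrite shift-var< n<c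
    | occ-var≢ (<⇒≢ (<-≤-trans n<c (m≤n⇒m≤1+n c≤k))) | occ-var≢ (<⇒≢ (<-≤-trans n<c c≤k)) = refl
... | tri≈ _ refl _ rewrite shift-var≥ {n} ≤-refl = refl
... | tri> _ _ c<n rewrite shift-var≥ (<⇒≤ c<n) = refl
occ-shift≥ (lam t) c≤k = occ-shift≥ t (s≤s c≤k)
occ-shift≥ (app t u) c≤k = cong₂ _+_ (occ-shift≥ t c≤k) (occ-shift≥ u c≤k)

occ-shift-self : ∀ c t → occ c (shift c t) ≡ 0
occ-shift-self c (var n) with <-cmp n c
... | tri< n<c _ _ rewrite shift-var< n<c = occ-var≢ (<⇒≢ n<c)
... | tri≈ _ refl _ rewrite shift-var≥ {n} ≤-refl = occ-var≢ (>⇒≢ (n<1+n n))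
... | tri> _ _ c<n rewrite shift-var≥ (<⇒≤ c<n) = occ-var≢ (>⇒≢ (m<n⇒m<1+n c<n))
occ-shift-self c (lam t) = occ-shift-self (suc c) t
occ-shift-self c (app t u) rewrite occ-shift-self c t | occ-shift-self c u = refl

private
  sum-of-affine : ∀ a b o₁ o₂ y → (a + o₁ * y) + (b + o₂ * y) ≡ (a + b) + (o₁ + o₂) * y
  sum-of-affine = solve-∀

occ-subst< : ∀ {j k s} t → k < j → occ k (subst j s t) ≡ occ k t + occ j t * occ k s
occ-subst< {j} {k} {s} (var n) k<j with <-cmp n j
... | tri< n<j _ _ rewrite subst-var< {s = s} n<j | occ-var≢ (<⇒≢ n<j) = ≡.sym (+-identityʳ _)
... | tri≈ _ refl _ rewrite subst-var≡ {n} {s} | occ-var≡ n | occ-var≢ (>⇒≢ k<j) = ≡.sym (+-identityʳ _)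
occ-subst< {j} {k} {s} (var (suc n)) k<j | tri> _ _ j<n
  rewrite subst-var> {s = s} j<n | occ-var≢ (>⇒≢ (<-≤-trans k<j (≤-pred j<n))) | occ-var≢ (>⇒≢ (<-trans k<j j<n))
        | occ-var≢ (>⇒≢ j<n) = refl
occ-subst< {j} {k} {s} (lam t) k<j rewrite occ-subst< {s = shift 0 s} t (s≤s k<j) | occ-shift≥ s (z≤n {k}) = refl
occ-subst< {j} {k} {s} (app t u) k<j
  rewrite occ-subst< {s = s} t k<j | occ-subst< {s = s} u k<j = sum-of-affine (occ k t) (occ k u) (occ j t) (occ j u) (occ k s)

occ-subst≥ : ∀ {j k s} t → j ≤ k → occ k (subst j s t) ≡ occ (suc k) t + occ j t * occ k s
occ-subst≥ {j} {k} {s} (var n) j≤k with <-cmp n j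
... | tri< n<j _ _ rewrite subst-var< {s = s} n<j | occ-var≢ (<⇒≢ n<j) | occ-var≢ (<⇒≢ (<-≤-trans n<j j≤k))
                         | occ-var≢ (<⇒≢ (<-≤-trans n<j (m≤n⇒m≤1+n j≤k))) = refl
... | tri≈ _ refl _ rewrite subst-var≡ {n} {s} | occ-var≡ n | occ-var≢ (<⇒≢ (s≤s j≤k)) = ≡.sym (+-identityʳ _)
occ-subst≥ {j} {k} {s} (var (suc n)) j≤k | tri> _ _ j<n
  rewrite subst-var> {s = s} j<n | occ-var≢ (>⇒≢ j<n) = ≡.sym (+-identityʳ _)
occ-subst≥ {j} {k} {s} (lam t) j≤k rewrite occ-subst≥ {s = shift 0 s} t (s≤s j≤k) | occ-shift≥ s (z≤n {k}) = refl
occ-subst≥ {j} {k} {s} (app t u) j≤k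
  rewrite occ-subst≥ {s = s} t j≤k | occ-subst≥ {s = s} u j≤k
    = sum-of-affine (occ (suc k) t) (occ (suc k) u) (occ j t) (occ j u) (occ k s)

occs : ℕ → List Tm → ℕ
occs k us = sum (map (occ k) us)

occ-apps : ∀ k t us → occ k (apps t us) ≡ occ k t + occs k us
occ-apps k t [] = ≡.sym (+-identityʳ _)
occ-apps k t (u ∷ us) = ≡.trans (occ-apps k (app t u) us) (+-assoc (occ k t) (occ k u) (occs k us))

occ-lams : ∀ k x t → occ x (lams k t) ≡ occ (k + x) t
occ-lams zero x t = refl
occ-lams (suc k) x t = ≡.trans (occ-lams k (suc x) t) (cong (λ n → occ n t) (+-suc k x))

subst-unused : ∀ {j s t} → Scoped (suc j) t → occ j t ≡ 0 → subst j s t ≡ t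
subst-unused {j} {s} (var {n} n<) unused with <-cmp n j
... | tri< n<j _ _ = subst-var< n<j
... | tri≈ _ refl _ rewrite occ-var≡ n with unused
... | ()
subst-unused (var n<) _ | tri> _ _ j<n = ⊥-elim (<⇒≱ j<n (≤-pred n<))
subst-unused {s = s} (lam t) unused = cong lam (subst-unused {s = shift 0 s} t unused)
subst-unused (app t u) unused = cong₂ app (subst-unused t (m+n≡0⇒m≡0 _ unused)) (subst-unused u (m+n≡0⇒n≡0 _ unused))

map-subst-unused : ∀ {j s us} → All (Scoped (suc j)) us → occs j us ≡ 0 → map (subst j s) us ≡ us
map-subst-unused [] _ = refl
map-subst-unused (su ∷ sus) unused =
  cong₂ _∷_ (subst-unused su (m+n≡0⇒m≡0 _ unused)) (map-subst-unused sus (m+n≡0⇒n≡0 _ unused))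

Linear-shift : ∀ c {t} → Linear t → Linear (shift c t)
Linear-shift c (var {n}) rewrite shift-var c n = var
Linear-shift c {lam t} (lam once Lt) = lam (≡.trans (occ-shift< t (s≤s (z≤n {c}))) once) (Linear-shift (suc c) Lt)
Linear-shift c (app Lt Lu) = app (Linear-shift c Lt) (Linear-shift c Lu)

Linear-subst : ∀ j {s t} → Linear t → Linear s → Linear (subst j s t)
Linear-subst j {s} (var {n}) Ls with <-cmp n j
... | tri< n<j _ _ rewrite subst-var< {s = s} n<j = var
... | tri≈ _ refl _ rewrite subst-var≡ {n} {s} = Ls
Linear-subst j {s} (var {suc n}) Ls | tri> _ _ j<n rewrite subst-var> {s = s} j<n = var
Linear-subst j {s} {lam t} (lam once Lt) Ls = lam once′ (Linear-subst (suc j) Lt (Linear-shift 0 Ls))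
  where
  once′ : occ 0 (subst (suc j) (shift 0 s) t) ≡ 1
  once′ rewrite occ-subst< {s = shift 0 s} t (s≤s (z≤n {j})) | occ-shift-self 0 s
        | *-zeroʳ (occ (suc j) t) | +-identityʳ (occ 0 t) = once
Linear-subst j (app Lt Lu) Ls = app (Linear-subst j Lt Ls) (Linear-subst j Lu Ls)

Linear-apps⁻ : ∀ {t us} → Linear (apps t us) → Linear t × All Linear us
Linear-apps⁻ {us = []} Lt = Lt , []
Linear-apps⁻ {t} {u ∷ us} Ltus with Linear-apps⁻ {app t u} {us} Ltus
... | app Lt Lu , Lus = Lt , Lu ∷ Lus

Linear-lams : ∀ k {t} → (∀ v → v < k → occ v t ≡ 1) → Linear t → Linear (lams k t)
Linear-lams zero _ Lt = Lt
Linear-lams (suc k) {t} once Lt =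
  lam (≡.trans (occ-lams k 0 t) (≡.trans (cong (λ n → occ n t) (+-identityʳ k)) (once k ≤-refl)))
      (Linear-lams k (λ v v<k → once v (m≤n⇒m≤1+n v<k)) Lt)

Linear-apps : ∀ {t us} → Linear t → All Linear us → Linear (apps t us)
Linear-apps Lt [] = Lt
Linear-apps Lt (Lu ∷ Lus) = Linear-apps (app Lt Lu) Lus

-- Normalisation of linear terms

size : Tm → ℕ
size (var _) = 1
size (lam t) = suc (size t)
size (app t u) = suc (size t + size u)

size-shift : ∀ c t → size (shift c t) ≡ size t
size-shift c (var n) rewrite shift-var c n = refl
size-shift c (lam t) = cong suc (size-shift (suc c) t)
size-shift c (app t u) = cong suc (cong₂ _+_ (size-shift c t) (size-shift c u))

size-subst : ∀ j s t → size (subst j s t) + occ j t ≡ size t + occ j t * size s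
size-subst j s (var n) with <-cmp n j
... | tri< n<j _ _ rewrite subst-var< {s = s} n<j | occ-var≢ (<⇒≢ n<j) = refl
... | tri≈ _ refl _ rewrite subst-var≡ {n} {s} | occ-var≡ n | +-identityʳ (size s) = +-comm (size s) 1
size-subst j s (var (suc n)) | tri> _ _ j<n rewrite subst-var> {s = s} j<n | occ-var≢ (>⇒≢ j<n) = refl
size-subst j s (lam t) rewrite ≡.sym (size-shift 0 s) = cong suc (size-subst (suc j) (shift 0 s) t)
size-subst j s (app t u) =
  arith (size (subst j s t)) (size (subst j s u)) (occ j t) (occ j u) (size t) (size u) (size s) (size-subst j s t) (size-subst j s u)
  where
  arith : ∀ a b o₁ o₂ A B S → a + o₁ ≡ A + o₁ * S → b + o₂ ≡ B + o₂ * S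
        → suc (a + b) + (o₁ + o₂) ≡ suc (A + B) + (o₁ + o₂) * S
  arith a b o₁ o₂ A B S e₁ e₂ = begin
    suc (a + b) + (o₁ + o₂)           ≡⟨ lhs a b o₁ o₂ ⟩
    suc ((a + o₁) + (b + o₂))         ≡⟨ cong suc (cong₂ _+_ e₁ e₂) ⟩
    suc ((A + o₁ * S) + (B + o₂ * S)) ≡⟨ cong suc (sum-of-affine A B o₁ o₂ S) ⟩
    suc (A + B) + (o₁ + o₂) * S       ∎
    where
    open ≡.≡-Reasoning
    lhs : ∀ a b o₁ o₂ → suc (a + b) + (o₁ + o₂) ≡ suc ((a + o₁) + (b + o₂))
    lhs = solve-∀

size-linear-β : ∀ b u → occ 0 b ≡ 1 → size (subst 0 u b) + 1 ≡ size b + size u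
size-linear-β b u once with size-subst 0 u b
... | e rewrite once | +-identityʳ (size u) = e

size-linear-redex : ∀ {b u′ t u} → occ 0 b ≡ 1 → size (lam b) ≤ size t → size u′ ≤ size u
                  → size (subst 0 u′ b) ≤ size t + size u
size-linear-redex {b} {u′} once λb≤t u′≤u =
  ≤-trans (m≤m+n _ 1) (≤-trans (≤-reflexive (size-linear-β b u′ once)) (+-mono-≤ (≤-trans (n≤1+n _) λb≤t) u′≤u))

mutual
  data Neutral : Tm → Set where
    var : ∀ {n} → Neutral (var n)
    app : ∀ {t u} → Neutral t → Normal u → Neutral (app t u)

  data Normal : Tm → Set where
    lam : ∀ {t} → Normal t → Normal (lam t)
    ne  : ∀ {t} → Neutral t → Normal t

record Normalisation (Γ : List Ty) (t : Tm) (T : Ty) : Set where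
  constructor normalised
  field
    nf     : Tm
    t=nf   : t =βη nf
    normal : Normal nf
    linear : Linear nf
    typed  : Γ ⊢ nf ∶ T
    size≤  : size nf ≤ size t
    occ≡   : ∀ k → occ k nf ≡ occ k t

-- Fuel bounds the size; a linear β-step strictly decreases it.
normalise : ∀ fuel {Γ t T} → size t ≤ fuel → Linear t → Γ ⊢ t ∶ T → Normalisation Γ t T
normalise zero {t = var _} () _ _
normalise zero {t = lam _} () _ _
normalise zero {t = app _ _} () _ _
normalise (suc n) _ var (var x) = normalised _ refl (ne var) var (var x) ≤-refl (λ _ → refl)
normalise (suc n) (s≤s ≤n) (lam once Lt) (lam ⊢t) with normalise n ≤n Lt ⊢t
... | normalised t′ t=t′ nt′ Lt′ ⊢t′ sz oc =
  normalised (lam t′) (lam t=t′) (lam nt′) (lam (≡.trans (oc 0) once) Lt′) (lam ⊢t′) (s≤s sz) (λ k → oc (suc k))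
normalise (suc n) {t = app t u} (s≤s ≤n) (app Lt Lu) (app ⊢t ⊢u)
  with normalise n (m+n≤o⇒m≤o (size t) ≤n) Lt ⊢t | normalise n (m+n≤o⇒n≤o (size t) ≤n) Lu ⊢u
... | normalised (lam b) t=λb (lam _) (lam once Lb) (lam ⊢b) szt oct | normalised u′ u=u′ _ Lu′ ⊢u′ szu ocu
  with normalise n (≤-trans (size-linear-redex once szt szu) ≤n) (Linear-subst 0 Lb Lu′) (⊢-subst [] ⊢b ⊢u′)
... | normalised r r=r′ nr Lr ⊢r szr ocr =
  normalised r (trans (app t=λb u=u′) (trans β r=r′)) nr Lr ⊢r
    (≤-trans szr (m≤n⇒m≤1+n (size-linear-redex once szt szu))) occ≡
  where
  occ≡ : ∀ k → occ k r ≡ occ k t + occ k u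
  occ≡ k rewrite ocr k | occ-subst≥ {s = u′} b (z≤n {k}) | once | +-identityʳ (occ k u′) = cong₂ _+_ (oct k) (ocu k)
normalise (suc n) {t = app t u} (s≤s ≤n) (app Lt Lu) (app ⊢t ⊢u)
  | normalised t′ t=t′ (ne nt′) Lt′ ⊢t′ szt oct | normalised u′ u=u′ nu′ Lu′ ⊢u′ szu ocu =
  normalised (app t′ u′) (app t=t′ u=u′) (ne (app nt′ nu′)) (app Lt′ Lu′) (app ⊢t′ ⊢u′)
             (s≤s (+-mono-≤ szt szu))
             (λ k → cong₂ _+_ (oct k) (ocu k))

-- η-long normal forms

arity : Ty → ℕ
arity p = 0
arity (A ⊸ B) = suc (arity B)

mutual
  data Long (Γ : List Ty) : Tm → Ty → Set where
    lam : ∀ {A B t} → Long (A ∷ Γ) t B → Long Γ (lam t) (A ⊸ B)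
    ne  : ∀ {x T us} → Γ ∋ x ∶ T → LongSpine Γ T p us → Long Γ (apps (var x) us) p

  data LongSpine (Γ : List Ty) : Ty → Ty → List Tm → Set where
    []  : ∀ {T} → LongSpine Γ T T []
    _∷_ : ∀ {A B T u us} → Long Γ u A → LongSpine Γ B T us → LongSpine Γ (A ⊸ B) T (u ∷ us)

shift-apps : ∀ c t us → shift c (apps t us) ≡ apps (shift c t) (map (shift c) us)
shift-apps c t [] = refl
shift-apps c t (u ∷ us) = shift-apps c (app t u) us

apps-snoc : ∀ t us u → apps t (us ++ [ u ]) ≡ app (apps t us) u
apps-snoc t us u = apps-++ t us [ u ]

mutual
  Long-weaken : ∀ Γ₁ {Γ₂ A t T} → Long (Γ₁ ++ Γ₂) t T → Long (Γ₁ ++ A ∷ Γ₂) (shift (length Γ₁) t) T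
  Long-weaken Γ₁ (lam {A = B} l) = lam (Long-weaken (B ∷ Γ₁) l)
  Long-weaken Γ₁ (ne {x = x} {us = us} x∈ sp)
    rewrite shift-apps (length Γ₁) (var x) us | shift-var (length Γ₁) x = ne (∋-weaken Γ₁ x∈) (LongSpine-weaken Γ₁ sp)

  LongSpine-weaken : ∀ Γ₁ {Γ₂ A T₀ T us} → LongSpine (Γ₁ ++ Γ₂) T₀ T us
                   → LongSpine (Γ₁ ++ A ∷ Γ₂) T₀ T (map (shift (length Γ₁)) us)
  LongSpine-weaken Γ₁ [] = []
  LongSpine-weaken Γ₁ (l ∷ sp) = Long-weaken Γ₁ l ∷ LongSpine-weaken Γ₁ sp

LongSpine-snoc : ∀ {Γ T₀ A B us u} → LongSpine Γ T₀ (A ⊸ B) us → Long Γ u A → LongSpine Γ T₀ B (us ++ [ u ])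
LongSpine-snoc [] l = l ∷ []
LongSpine-snoc (l′ ∷ sp) l = l′ ∷ LongSpine-snoc sp l

η-expand : Ty → Tm → Tm
η-expand p t = t
η-expand (A ⊸ B) t = lam (η-expand B (app (shift 0 t) (η-expand A (var 0))))

η-expand-Long : ∀ T {Γ x T₀ us} → Γ ∋ x ∶ T₀ → LongSpine Γ T₀ T us → Long Γ (η-expand T (apps (var x) us)) T
η-expand-Long p x∈ sp = ne x∈ sp
η-expand-Long (A ⊸ B) {Γ} {x} {us = us} x∈ sp =
  lam (≡.subst (λ t → Long (A ∷ Γ) (η-expand B t) B) weakened-spine
    (η-expand-Long B (there x∈) (LongSpine-snoc (LongSpine-weaken [] sp) (η-expand-Long A here []))))
  where
  weakened-spine : apps (var (suc x)) (map (shift 0) us ++ [ η-expand A (var 0) ])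
                 ≡ app (shift 0 (apps (var x) us)) (η-expand A (var 0))
  weakened-spine rewrite apps-snoc (var (suc x)) (map (shift 0) us) (η-expand A (var 0)) | shift-apps 0 (var x) us = refl

η-expand-βη : ∀ T t → η-expand T t =βη t
η-expand-βη p t = refl
η-expand-βη (A ⊸ B) t = trans (lam (trans (η-expand-βη B _) (app refl (η-expand-βη A (var 0))))) η

occ-η-expand : ∀ T k t → occ k (η-expand T t) ≡ occ k t
occ-η-expand p k t = refl
occ-η-expand (A ⊸ B) k t
  rewrite occ-η-expand B (suc k) (app (shift 0 t) (η-expand A (var 0))) | occ-η-expand A (suc k) (var 0)
        | occ-shift≥ {0} t (z≤n {k}) = +-identityʳ (occ k t)

Linear-η-expand : ∀ T {t} → Linear t → Linear (η-expand T t)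
Linear-η-expand p Lt = Lt
Linear-η-expand (A ⊸ B) {t} Lt = lam once (Linear-η-expand B (app (Linear-shift 0 Lt) (Linear-η-expand A var)))
  where
  once : occ 0 (η-expand B (app (shift 0 t) (η-expand A (var 0)))) ≡ 1
  once rewrite occ-η-expand B 0 (app (shift 0 t) (η-expand A (var 0))) | occ-η-expand A 0 (var 0) | occ-shift-self 0 t = refl

record LongNeutral (Γ : List Ty) (t : Tm) (T : Ty) : Set where
  constructor longNeutral
  field
    head      : ℕ
    headType  : Ty
    spine     : List Tm
    t=nf      : t =βη apps (var head) spine
    head∈     : Γ ∋ head ∶ headType
    longSpine : LongSpine Γ headType T spine
    linear    : Linear (apps (var head) spine)
    occ≡      : ∀ k → occ k (apps (var head) spine) ≡ occ k t

record LongForm (Γ : List Ty) (t : Tm) (T : Ty) : Set where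
  constructor longForm
  field
    nf     : Tm
    t=nf   : t =βη nf
    long   : Long Γ nf T
    linear : Linear nf
    occ≡   : ∀ k → occ k nf ≡ occ k t

mutual
  η-long-neutral : ∀ {Γ t T} → Neutral t → Linear t → Γ ⊢ t ∶ T → LongNeutral Γ t T
  η-long-neutral var var (var x∈) = longNeutral _ _ [] refl x∈ [] var (λ _ → refl)
  η-long-neutral (app nt nu) (app Lt Lu) (app ⊢t ⊢u) with η-long-neutral nt Lt ⊢t | η-long-normal nu Lu ⊢u
  ... | longNeutral x T₀ us t=xus x∈ sp Lxus oc | longForm u′ u=u′ lu′ Lu′ ocu =
    longNeutral x T₀ (us ++ [ u′ ]) (≡.subst (app _ _ =βη_) (≡.sym snoc) (app t=xus u=u′)) x∈ (LongSpine-snoc sp lu′)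
                (≡.subst Linear (≡.sym snoc) (app Lxus Lu′)) (λ k → ≡.trans (cong (occ k) snoc) (cong₂ _+_ (oc k) (ocu k)))
    where
    snoc : apps (var x) (us ++ [ u′ ]) ≡ app (apps (var x) us) u′
    snoc = apps-snoc (var x) us u′

  η-long-normal : ∀ {Γ t T} → Normal t → Linear t → Γ ⊢ t ∶ T → LongForm Γ t T
  η-long-normal (lam nt) (lam once Lt) (lam ⊢t) with η-long-normal nt Lt ⊢t
  ... | longForm t′ t=t′ lt′ Lt′ oc
      = longForm (lam t′) (lam t=t′) (lam lt′) (lam (≡.trans (oc 0) once) Lt′) (λ k → oc (suc k))
  η-long-normal {T = T} (ne nt) Lt ⊢t with η-long-neutral nt Lt ⊢t
  ... | longNeutral x T₀ us t=xus x∈ sp Lxus oc =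
    longForm (η-expand T (apps (var x) us)) (trans t=xus (sym (η-expand-βη T _))) (η-expand-Long T x∈ sp)
             (Linear-η-expand T Lxus) (λ k → ≡.trans (occ-η-expand T k _) (oc k))

longNormalise : ∀ {Γ A t} → Γ ⊢ t ∶ A → Linear t → LongForm Γ t A
longNormalise {t = t} ⊢t Lt with normalise (size t) ≤-refl Lt ⊢t
... | normalised t′ t=t′ nt′ Lt′ ⊢t′ _ oc with η-long-normal nt′ Lt′ ⊢t′
... | longForm t″ t′=t″ lt″ Lt″ oc′ = longForm t″ (trans t=t′ t′=t″) lt″ Lt″ (λ k → ≡.trans (oc′ k) (oc k))

mutual
  Long-Scoped : ∀ {Γ t T} → Long Γ t T → Scoped (length Γ) t
  Long-Scoped (lam d) = lam (Long-Scoped d)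
  Long-Scoped (ne x∈ sp) = Scoped-apps (var (∋⇒< x∈)) (LongSpine-Scoped sp)

  LongSpine-Scoped : ∀ {Γ T₀ T us} → LongSpine Γ T₀ T us → All (Scoped (length Γ)) us
  LongSpine-Scoped [] = []
  LongSpine-Scoped (d ∷ sp) = Long-Scoped d ∷ LongSpine-Scoped sp

length-LongSpine : ∀ {Γ T₀ us} → LongSpine Γ T₀ p us → length us ≡ arity T₀
length-LongSpine [] = refl
length-LongSpine (_ ∷ sp) = cong suc (length-LongSpine sp)

-- Observation trees

Pos : Set
Pos = List (ℕ × ℕ)

data Tree : Set where
  node : Pos → List Tree → Tree

Scope : Set
Scope = List (Pos × Ty)

types : Scope → List Ty
types = map proj₂

posOf : Scope → ℕ → Pos
posOf [] _ = []
posOf ((π , _) ∷ Δ) zero = π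
posOf (_ ∷ Δ) (suc x) = posOf Δ x

-- The binder j of argument l of a head bound at π sits at position (l , j) ∷ π;
-- a node records the position of the binder of its head variable.
mutual
  observe : ∀ Δ → Pos → ℕ → ℕ → ∀ {t T} → Long (types Δ) t T → Tree
  observe Δ π l j (lam {A = A} d) = observe ((((l , j) ∷ π) , A) ∷ Δ) π l (suc j) d
  observe Δ π l j (ne {x = x} _ sp) = node (posOf Δ x) (observeSpine Δ (posOf Δ x) 0 sp)

  observeSpine : ∀ Δ → Pos → ℕ → ∀ {T₀ T us} → LongSpine (types Δ) T₀ T us → List Tree
  observeSpine Δ π i [] = []
  observeSpine Δ π i (d ∷ sp) = observe Δ π i 0 d ∷ observeSpine Δ π (suc i) sp

node-injective : ∀ {π₁ π₂ cs₁ cs₂} → node π₁ cs₁ ≡ node π₂ cs₂ → π₁ ≡ π₂ × cs₁ ≡ cs₂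
node-injective refl = refl , refl

∋-scope : ∀ {Δ x T} → types Δ ∋ x ∶ T → x < length Δ
∋-scope {Δ} x∈ = ≡.subst (_ <_) (length-map proj₂ Δ) (∋⇒< x∈)

record _≤occ_ (t t′ : Tm) : Set where
  constructor pointwise
  field occ-≤ : ∀ k → occ k t ≤ occ k t′

-- Positions grow at the front, so posOf Δ y ≡ ext ++ posOf Δ x with ext ≢ [] says that y
-- is bound inside an argument of x. As x occurs once, no variable in scope is bound below
-- a free variable of the term still to be observed, which keeps the positions distinct.
PositionsDistinct : Scope → Set
PositionsDistinct Δ = ∀ {x y} → x < length Δ → y < length Δ → posOf Δ x ≡ posOf Δ y → x ≡ y

NothingBelowFree : Scope → Tm → Set
NothingBelowFree Δ t =
  ∀ {x y} ext → x < length Δ → y < length Δ → 1 ≤ occ x t → posOf Δ y ≡ ext ++ posOf Δ x → ext ≡ []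

Affine : Scope → Tm → Set
Affine Δ t = ∀ {x} → x < length Δ → occ x t ≤ 1

SlotsFresh : Scope → Pos → ℕ → ℕ → Set
SlotsFresh Δ π l j = ∀ {y} ext j′ → y < length Δ → j ≤ j′ → posOf Δ y ≢ ext ++ ((l , j′) ∷ π)

SlotNotBelowFree : Scope → Pos → ℕ → Tm → Set
SlotNotBelowFree Δ π l t =
  ∀ {x} ext j′ → x < length Δ → 1 ≤ occ x t → ext ≢ [] → ((l , j′) ∷ π) ≢ ext ++ posOf Δ x

record Observable (Δ : Scope) (π : Pos) (l : ℕ) (t : Tm) : Set where
  field
    linear           : Linear t
    nothingBelowFree : NothingBelowFree Δ t
    affine           : Affine Δ t
    slotNotBelowFree : SlotNotBelowFree Δ π l t

Observable-closed : ∀ {π l t} → Linear t → Observable [] π l t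
Observable-closed Lt = record { linear = Lt ; nothingBelowFree = λ _ () ; affine = λ () ; slotNotBelowFree = λ _ _ () }

++-[_]≢[] : ∀ {A : Set} ext (b : A) → ext ++ [ b ] ≢ []
++-[_]≢[] [] _ ()
++-[_]≢[] (_ ∷ _) _ ()

∷-≡-++-∷ : ∀ {A : Set} {a b : A} {xs} ext → a ∷ xs ≡ ext ++ b ∷ xs → ext ≡ [] × a ≡ b
∷-≡-++-∷ [] e = refl , proj₁ (∷-injective e)
∷-≡-++-∷ {b = b} {xs} (c ∷ ext) e with ++-identityˡ-unique (ext ++ [ b ])
  (≡.trans (∷-injectiveʳ e) (≡.sym (++-assoc ext [ b ] xs)))
... | ext++b≡[] = ⊥-elim (++-[ ext ]≢[] b ext++b≡[])

module _ {Δ : Scope} {π : Pos} {l j : ℕ} {A : Ty} where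
  private
    Δ′ : Scope
    Δ′ = (((l , j) ∷ π) , A) ∷ Δ

  bind-PositionsDistinct : PositionsDistinct Δ → SlotsFresh Δ π l j → PositionsDistinct Δ′
  bind-PositionsDistinct _ _ {zero} {zero} _ _ _ = refl
  bind-PositionsDistinct _ fresh {zero} {suc y} _ (s≤s y<) e = ⊥-elim (fresh [] j y< ≤-refl (≡.sym e))
  bind-PositionsDistinct _ fresh {suc x} {zero} (s≤s x<) _ e = ⊥-elim (fresh [] j x< ≤-refl e)
  bind-PositionsDistinct distinct _ {suc x} {suc y} (s≤s x<) (s≤s y<) e = cong suc (distinct x< y< e)

  bind-SlotsFresh : SlotsFresh Δ π l j → SlotsFresh Δ′ π l (suc j)
  bind-SlotsFresh _ {zero} ext j′ _ j<j′ e = <-irrefl (cong proj₂ (proj₂ (∷-≡-++-∷ ext e))) j<j′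
  bind-SlotsFresh fresh {suc y} ext j′ (s≤s y<) j<j′ e = fresh ext j′ y< (≤-trans (n≤1+n j) j<j′) e

  bind-Observable : ∀ {t} → SlotsFresh Δ π l j → Observable Δ π l (lam t) → Observable Δ′ π l t
  bind-Observable {t} fresh obs = record
    { linear = body-linear linear ; nothingBelowFree = below′ ; affine = affine′ ; slotNotBelowFree = slot′ }
    where
    open Observable obs
    body-linear : Linear (lam t) → Linear t
    body-linear (lam _ Lt) = Lt
    once : Linear (lam t) → occ 0 t ≡ 1
    once (lam o _) = o
    below′ : NothingBelowFree Δ′ t
    below′ {zero} {zero} ext _ _ _ e = ++-identityˡ-unique ext e
    below′ {zero} {suc y} ext _ (s≤s y<) _ e = ⊥-elim (fresh ext j y< ≤-refl e)
    below′ {suc x} {zero} [] _ _ _ _ = refl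
    below′ {suc x} {zero} (c ∷ ext) (s≤s x<) _ occurs e = ⊥-elim (slotNotBelowFree (c ∷ ext) j x< occurs (λ ()) e)
    below′ {suc x} {suc y} ext (s≤s x<) (s≤s y<) occurs e = nothingBelowFree ext x< y< occurs e
    affine′ : Affine Δ′ t
    affine′ {zero} _ = ≤-reflexive (once linear)
    affine′ {suc x} (s≤s x<) = affine x<
    slot′ : SlotNotBelowFree Δ′ π l t
    slot′ {zero} ext j′ _ _ ext≢[] e = ext≢[] (proj₁ (∷-≡-++-∷ ext e))
    slot′ {suc x} ext j′ (s≤s x<) occurs ext≢[] e = slotNotBelowFree ext j′ x< occurs ext≢[] e

record SpineState (Δ : Scope) (hp : Pos) (us : List Tm) : Set where
  field
    head             : ℕ
    head<            : head < length Δ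
    head-pos         : posOf Δ head ≡ hp
    linear           : All Linear us
    nothingBelowFree : NothingBelowFree Δ (apps (var head) us)
    affine           : Affine Δ (apps (var head) us)

NothingBelowFree-mono : ∀ {Δ t t′} → t ≤occ t′ → NothingBelowFree Δ t′ → NothingBelowFree Δ t
NothingBelowFree-mono (pointwise t≤t′) below ext x< y< occurs = below ext x< y< (≤-trans occurs (t≤t′ _))

Affine-mono : ∀ {Δ t t′} → t ≤occ t′ → Affine Δ t′ → Affine Δ t
Affine-mono (pointwise t≤t′) aff x< = ≤-trans (t≤t′ _) (aff x<)

occ-head≥1 : ∀ x us → 1 ≤ occ x (apps (var x) us)
occ-head≥1 x us rewrite occ-apps x (var x) us | occ-var≡ x = s≤s z≤n

spine-start : ∀ {Δ π l x us} → Observable Δ π l (apps (var x) us) → x < length Δ → SpineState Δ (posOf Δ x) us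
spine-start {x = x} obs x< = record
  { head = x ; head< = x< ; head-pos = refl ; linear = proj₂ (Linear-apps⁻ (Observable.linear obs))
  ; nothingBelowFree = Observable.nothingBelowFree obs ; affine = Observable.affine obs }

apps-≤occ-drop : ∀ t u us → apps t us ≤occ apps t (u ∷ us)
apps-≤occ-drop t u us = pointwise λ k → ≡.subst₂ _≤_ (≡.sym (occ-apps k t us)) (≡.sym (occ-apps k t (u ∷ us)))
  (+-monoʳ-≤ (occ k t) (m≤n+m (occs k us) (occ k u)))

apps-≤occ-arg : ∀ t u us → u ≤occ apps t (u ∷ us)
apps-≤occ-arg t u us = pointwise λ k → ≡.subst (occ k u ≤_) (≡.sym (occ-apps k t (u ∷ us)))
  (≤-trans (m≤m+n (occ k u) (occs k us)) (m≤n+m _ (occ k t)))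

spine-tail : ∀ {Δ hp u us} → SpineState Δ hp (u ∷ us) → SpineState Δ hp us
spine-tail {Δ} {u = u} {us} st = record
  { head = head ; head< = head< ; head-pos = head-pos ; linear = All.tail linear
  ; nothingBelowFree = NothingBelowFree-mono {Δ} (apps-≤occ-drop (var head) u us) nothingBelowFree
  ; affine = Affine-mono {Δ} (apps-≤occ-drop (var head) u us) affine }
  where
  open SpineState st

spine-SlotsFresh : ∀ {Δ hp us} i → SpineState Δ hp us → SlotsFresh Δ hp i 0
spine-SlotsFresh {Δ} {hp} {us} i st {y} ext j′ y< _ e
  = ++-[ ext ]≢[] (i , j′) (nothingBelowFree (ext ++ [ (i , j′) ]) head< y< (occ-head≥1 head us) e′)
  where
  open SpineState st
  e′ : posOf Δ y ≡ (ext ++ [ (i , j′) ]) ++ posOf Δ head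
  e′ rewrite ++-assoc ext [ (i , j′) ] (posOf Δ head) | head-pos = e

spine-Observable : ∀ {Δ hp u us} i → PositionsDistinct Δ → SpineState Δ hp (u ∷ us) → Observable Δ hp i u
spine-Observable {Δ} {hp} {u} {us} i distinct st = record
  { linear = All.head linear
  ; nothingBelowFree = NothingBelowFree-mono {Δ} (apps-≤occ-arg (var head) u us) nothingBelowFree
  ; affine = Affine-mono {Δ} (apps-≤occ-arg (var head) u us) affine
  ; slotNotBelowFree = slot }
  where
  open SpineState st
  head∉u : occ head u ≡ 0
  head∉u = n≤0⇒n≡0 (m+n≤o⇒m≤o (occ head u) (≤-pred (≡.subst (_≤ 1) occ-head (affine head<))))
    where
    occ-head : occ head (apps (var head) (u ∷ us)) ≡ suc (occ head u + occs head us)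
    occ-head rewrite occ-apps head (var head) (u ∷ us) | occ-var≡ head = refl
  slot : SlotNotBelowFree Δ hp i u
  slot [] _ _ _ ext≢[] _ = ext≢[] refl
  slot {x} (_ ∷ []) _ x< occurs _ e with distinct head< x< (≡.trans head-pos (∷-injectiveʳ e))
  ... | refl = <-irrefl (≡.sym head∉u) occurs
  slot {x} (_ ∷ d ∷ ext) _ x< occurs _ e
    with nothingBelowFree (d ∷ ext) x< head< (≤-trans occurs (_≤occ_.occ-≤ (apps-≤occ-arg (var head) u us) x))
                          (≡.trans head-pos (∷-injectiveʳ e))
  ... | ()

mutual
  observe-injective : ∀ Δ π l j {t₁ t₂ T} (d₁ : Long (types Δ) t₁ T) (d₂ : Long (types Δ) t₂ T)
    → PositionsDistinct Δ → SlotsFresh Δ π l j → Observable Δ π l t₁ → Observable Δ π l t₂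
    → observe Δ π l j d₁ ≡ observe Δ π l j d₂ → t₁ ≡ t₂
  observe-injective Δ π l j (lam {A = A} d₁) (lam d₂) distinct fresh obs₁ obs₂ e =
    cong lam (observe-injective _ π l (suc j) d₁ d₂ (bind-PositionsDistinct distinct fresh) (bind-SlotsFresh {A = A} fresh)
                                (bind-Observable fresh obs₁) (bind-Observable fresh obs₂) e)
  observe-injective Δ π l j (ne {x = x₁} x₁∈ sp₁) (ne {x = x₂} x₂∈ sp₂) distinct fresh obs₁ obs₂ e
    with node-injective e
  ... | pos≡ , children≡ with distinct (∋-scope x₁∈) (∋-scope x₂∈) pos≡
  ... | refl with ∋-functional x₁∈ x₂∈
  ... | refl = cong (apps (var x₁)) (observeSpine-injective Δ (posOf Δ x₁) 0 sp₁ sp₂ distinct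
                                       (spine-start obs₁ (∋-scope x₁∈)) (spine-start obs₂ (∋-scope x₂∈)) children≡)

  observeSpine-injective : ∀ Δ hp i {T₀ us₁ us₂} (sp₁ : LongSpine (types Δ) T₀ p us₁)
                           (sp₂ : LongSpine (types Δ) T₀ p us₂)
    → PositionsDistinct Δ → SpineState Δ hp us₁ → SpineState Δ hp us₂
    → observeSpine Δ hp i sp₁ ≡ observeSpine Δ hp i sp₂ → us₁ ≡ us₂
  observeSpine-injective Δ hp i [] [] _ _ _ _ = refl
  observeSpine-injective Δ hp i (d₁ ∷ sp₁) (d₂ ∷ sp₂) distinct st₁ st₂ e =
    cong₂ _∷_ (observe-injective Δ hp i 0 d₁ d₂ distinct (spine-SlotsFresh i st₁)
                                 (spine-Observable i distinct st₁) (spine-Observable i distinct st₂) (proj₁ (∷-injective e)))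
              (observeSpine-injective Δ hp (suc i) sp₁ sp₂ distinct
                (spine-tail st₁) (spine-tail st₂) (proj₂ (∷-injective e)))

length-observeSpine : ∀ Δ hp i {T₀ us} (sp : LongSpine (types Δ) T₀ p us) → length (observeSpine Δ hp i sp) ≡ arity T₀
length-observeSpine Δ hp i [] = refl
length-observeSpine Δ hp i (_ ∷ sp) = cong suc (length-observeSpine Δ hp (suc i) sp)

-- Separating observation trees

Label : Set
Label = Pos × ℕ

_≟ˡ_ : DecidableEquality Label
_≟ˡ_ = Productₚ.≡-dec (Listₚ.≡-dec (Productₚ.≡-dec _≟_ _≟_)) _≟_

labelOf : Tree → Label
labelOf (node π cs) = π , length cs

Path : Set
Path = List (ℕ × ℕ)

-- A path step (i , k) enters child i of a node with k children; k is needed to project.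
data SubtreeAt : Tree → Path → Tree → Set where
  here : ∀ {T} → SubtreeAt T [] T
  step : ∀ {π cs i c ps S} → Lookup cs i c → SubtreeAt c ps S → SubtreeAt (node π cs) ((i , length cs) ∷ ps) S

record Separation (T₁ T₂ : Tree) : Set where
  constructor separation
  field
    path    : Path
    {S₁ S₂} : Tree
    at₁     : SubtreeAt T₁ path S₁
    at₂     : SubtreeAt T₂ path S₂
    labels≢ : labelOf S₁ ≢ labelOf S₂

ChildSeparation : List Tree → List Tree → Set
ChildSeparation cs₁ cs₂ = ∃[ i ] ∃[ c₁ ] ∃[ c₂ ] Lookup cs₁ i c₁ × Lookup cs₂ i c₂ × Separation c₁ c₂

mutual
  separate : (T₁ T₂ : Tree) → T₁ ≡ T₂ ⊎ Separation T₁ T₂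
  separate (node π₁ cs₁) (node π₂ cs₂) with (π₁ , length cs₁) ≟ˡ (π₂ , length cs₂)
  ... | no ℓ≢ = inj₂ (separation [] here here ℓ≢)
  ... | yes ℓ≡ with cong proj₁ ℓ≡ | separateAll cs₁ cs₂ (cong proj₂ ℓ≡)
  ... | refl | inj₁ refl = inj₁ refl
  ... | refl | inj₂ (i , _ , _ , l₁ , l₂ , separation ps at₁ at₂ ≢) =
    inj₂ (separation ((i , length cs₁) ∷ ps) (step l₁ at₁)
                     (≡.subst (λ k → SubtreeAt (node π₁ cs₂) ((i , k) ∷ ps) _) (≡.sym (cong proj₂ ℓ≡)) (step l₂ at₂)) ≢)

  separateAll : (cs₁ cs₂ : List Tree) → length cs₁ ≡ length cs₂ → cs₁ ≡ cs₂ ⊎ ChildSeparation cs₁ cs₂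
  separateAll [] [] _ = inj₁ refl
  separateAll (c₁ ∷ cs₁) (c₂ ∷ cs₂) len≡ with separate c₁ c₂
  ... | inj₂ s = inj₂ (0 , c₁ , c₂ , here , here , s)
  ... | inj₁ refl with separateAll cs₁ cs₂ (cong pred len≡)
  ...   | inj₁ refl = inj₁ refl
  ...   | inj₂ (i , d₁ , d₂ , l₁ , l₂ , s) = inj₂ (suc i , d₁ , d₂ , there l₁ , there l₂ , s)

-- The separating context

flat : ℕ → Ty
flat zero = p
flat (suc k) = p ⊸ flat k

flat-order : ∀ k → order (flat k) ≤ 2
flat-order zero = s≤s z≤n
flat-order (suc k) = ⊔-lub ≤-refl (flat-order k)

labelType : Label → Ty
labelType (_ , k) = flat k

mutual
  countG : Ty → ℕ
  countG T = suc (countA T)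

  countA : Ty → ℕ
  countA p = 0
  countA (D ⊸ T) = countR D + countA T

  countR : Ty → ℕ
  countR p = 0
  countR (E ⊸ D) = countG E + countR D

mutual
  labelsG : Ty → Pos → List Label
  labelsG T π = (π , arity T) ∷ labelsA T π 0

  labelsA : Ty → Pos → ℕ → List Label
  labelsA p π i = []
  labelsA (D ⊸ T) π i = labelsR D π i 0 ++ labelsA T π (suc i)

  labelsR : Ty → Pos → ℕ → ℕ → List Label
  labelsR p π i j = []
  labelsR (E ⊸ D) π i j = labelsG E ((i , j) ∷ π) ++ labelsR D π i (suc j)

mutual
  length-labelsG : ∀ T π → length (labelsG T π) ≡ countG T
  length-labelsG T π = cong suc (length-labelsA T π 0)

  length-labelsA : ∀ T π i → length (labelsA T π i) ≡ countA T
  length-labelsA p π i = refl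
  length-labelsA (D ⊸ T) π i = ≡.trans (length-++ (labelsR D π i 0))
    (cong₂ _+_ (length-labelsR D π i 0) (length-labelsA T π (suc i)))

  length-labelsR : ∀ D π i j → length (labelsR D π i j) ≡ countR D
  length-labelsR p π i j = refl
  length-labelsR (E ⊸ D) π i j = ≡.trans (length-++ (labelsG E _)) (cong₂ _+_ (length-labelsG E _) (length-labelsR D π i (suc j)))

-- generic T π δ c is the η-expansion at type T whose heads are fresh variables of flat
-- type, one for each binder of T; δ binders separate it from those variables and c is the
-- first of them it uses.
mutual
  generic : Ty → Pos → ℕ → ℕ → Tm
  generic T π δ c = lams (arity T) (apps (var (arity T + δ + c)) (genericArgs T π (arity T + δ) (suc c) 0))

  genericArgs : Ty → Pos → ℕ → ℕ → ℕ → List Tm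
  genericArgs p π δ c i = []
  genericArgs (D ⊸ T) π δ c i = apps (var (arity T)) (generics D π i 0 δ c) ∷ genericArgs T π δ (c + countR D) (suc i)

  generics : Ty → Pos → ℕ → ℕ → ℕ → ℕ → List Tm
  generics p π i j δ c = []
  generics (E ⊸ D) π i j δ c = generic E ((i , j) ∷ π) δ c ∷ generics D π i (suc j) δ (c + countG E)

Segment : List Label → ℕ → List Label → Set
Segment L c xs = ∀ {m ℓ} → Lookup xs m ℓ → Lookup L (c + m) ℓ

Segment-head : ∀ {L c ℓ xs} → Segment L c (ℓ ∷ xs) → Lookup L c ℓ
Segment-head {L} {c} {ℓ} seg = ≡.subst (λ k → Lookup L k ℓ) (+-identityʳ c) (seg here)

Segment-tail : ∀ {L c ℓ xs} → Segment L c (ℓ ∷ xs) → Segment L (suc c) xs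
Segment-tail {L} {c} seg {m} {ℓ} l = ≡.subst (λ k → Lookup L k ℓ) (+-suc c m) (seg (there l))

Segment-++ˡ : ∀ {L c xs ys} → Segment L c (xs ++ ys) → Segment L c xs
Segment-++ˡ seg l = seg (Lookup-++ˡ l)

Segment-++ʳ : ∀ {L c xs ys} → Segment L c (xs ++ ys) → Segment L (c + length xs) ys
Segment-++ʳ {L} {c} {xs} seg {m} {ℓ} l = ≡.subst (λ k → Lookup L k ℓ) (≡.sym (+-assoc c (length xs) m))
  (seg (Lookup-++ʳ xs l))

infixr 30 _⊸⋆_
_⊸⋆_ : List Ty → Ty → Ty
[] ⊸⋆ T = T
(Y ∷ Ys) ⊸⋆ T = Ys ⊸⋆ (Y ⊸ T)

⊸⋆-++ : ∀ Xs Ys T → (Xs ++ Ys) ⊸⋆ T ≡ Ys ⊸⋆ (Xs ⊸⋆ T)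
⊸⋆-++ [] Ys T = refl
⊸⋆-++ (X ∷ Xs) Ys T = ⊸⋆-++ Xs Ys (X ⊸ T)

lams-suc : ∀ n t → lams (suc n) t ≡ lams n (lam t)
lams-suc zero t = refl
lams-suc (suc n) t = cong lam (lams-suc n t)

lams-⊢ : ∀ Ys {Γ t T} → (Ys ++ Γ) ⊢ t ∶ T → Γ ⊢ lams (length Ys) t ∶ (Ys ⊸⋆ T)
lams-⊢ [] ⊢t = ⊢t
lams-⊢ (Y ∷ Ys) {Γ} {t} {T} ⊢t = ≡.subst (λ u → Γ ⊢ u ∶ (Ys ⊸⋆ (Y ⊸ T))) (≡.sym (lams-suc (length Ys) t))
  (lams-⊢ Ys (lam ⊢t))

domainsʳ : Ty → List Ty
domainsʳ p = []
domainsʳ (A ⊸ B) = domainsʳ B ++ [ A ]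

length-domainsʳ : ∀ T → length (domainsʳ T) ≡ arity T
length-domainsʳ p = refl
length-domainsʳ (A ⊸ B) = ≡.trans (length-++ (domainsʳ B))
  (≡.trans (+-comm (length (domainsʳ B)) 1) (cong suc (length-domainsʳ B)))

domainsʳ-⊸⋆ : ∀ T → domainsʳ T ⊸⋆ p ≡ T
domainsʳ-⊸⋆ p = refl
domainsʳ-⊸⋆ (A ⊸ B) = ≡.trans (⊸⋆-++ (domainsʳ B) [ A ] p) (cong (A ⊸_) (domainsʳ-⊸⋆ B))

lams-arity-⊢ : ∀ T {Γ t} → (domainsʳ T ++ Γ) ⊢ t ∶ p → Γ ⊢ lams (arity T) t ∶ T
lams-arity-⊢ T {Γ} {t} ⊢t = ≡.subst₂ (λ n U → Γ ⊢ lams n t ∶ U) (length-domainsʳ T) (domainsʳ-⊸⋆ T)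
  (lams-⊢ (domainsʳ T) ⊢t)

infix 4 _⊢*_∶_
data _⊢*_∶_ (Γ : List Ty) : List Tm → Ty → Set where
  []  : Γ ⊢* [] ∶ p
  _∷_ : ∀ {u us A B} → Γ ⊢ u ∶ A → Γ ⊢* us ∶ B → Γ ⊢* (u ∷ us) ∶ (A ⊸ B)

apps-⊢ : ∀ {Γ t D us} → Γ ⊢ t ∶ D → Γ ⊢* us ∶ D → Γ ⊢ apps t us ∶ p
apps-⊢ ⊢t [] = ⊢t
apps-⊢ ⊢t (⊢u ∷ ⊢us) = apps-⊢ (app ⊢t ⊢u) ⊢us

∋-++-∷ : ∀ Xs {A Ys} → (Xs ++ A ∷ Ys) ∋ length Xs ∶ A
∋-++-∷ [] = here
∋-++-∷ (_ ∷ Xs) = there (∋-++-∷ Xs)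

∋-++ʳ : ∀ Xs {Ys n T} → Ys ∋ n ∶ T → (Xs ++ Ys) ∋ length Xs + n ∶ T
∋-++ʳ [] x = x
∋-++ʳ (_ ∷ Xs) x = there (∋-++ʳ Xs x)

FlatVars : List Ty → ℕ → List Label → Set
FlatVars Γ δ L = ∀ {c ℓ} → Lookup L c ℓ → Γ ∋ δ + c ∶ labelType ℓ

FlatVars-weaken : ∀ Xs {Γ δ L} → FlatVars Γ δ L → FlatVars (Xs ++ Γ) (length Xs + δ) L
FlatVars-weaken Xs {Γ} {δ} fv {c} {ℓ} l = ≡.subst (λ k → (Xs ++ Γ) ∋ k ∶ labelType ℓ) (≡.sym (+-assoc (length Xs) δ c))
  (∋-++ʳ Xs (fv l))

mutual
  generic-⊢ : ∀ T π δ c {Γ L} → FlatVars Γ δ L → Segment L c (labelsG T π) → Γ ⊢ generic T π δ c ∶ T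
  generic-⊢ T π δ c {Γ} {L} fv seg = lams-arity-⊢ T (apps-⊢ (var (fv′ (Segment-head seg)))
    (genericArgs-⊢ T π (arity T + δ) (suc c) 0 fv′ (Segment-tail seg)))
    where
    fv′ : FlatVars (domainsʳ T ++ Γ) (arity T + δ) L
    fv′ = ≡.subst (λ n → FlatVars (domainsʳ T ++ Γ) (n + δ) L) (length-domainsʳ T) (FlatVars-weaken (domainsʳ T) fv)

  genericArgs-⊢ : ∀ T π δ c i {Γ L} → FlatVars (domainsʳ T ++ Γ) δ L → Segment L c (labelsA T π i)
                → (domainsʳ T ++ Γ) ⊢* genericArgs T π δ c i ∶ flat (arity T)
  genericArgs-⊢ p π δ c i fv seg = []
  genericArgs-⊢ (D ⊸ T) π δ c i {Γ} {L} fv seg rewrite ++-assoc (domainsʳ T) [ D ] Γ =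
    apps-⊢ (var (≡.subst (λ n → (domainsʳ T ++ D ∷ Γ) ∋ n ∶ D) (length-domainsʳ T) (∋-++-∷ (domainsʳ T))))
           (generics-⊢ D π i 0 δ c fv (Segment-++ˡ seg))
    ∷ genericArgs-⊢ T π δ (c + countR D) (suc i) {D ∷ Γ} fv
        (≡.subst (λ n → Segment L (c + n) (labelsA T π (suc i))) (length-labelsR D π i 0) (Segment-++ʳ seg))

  generics-⊢ : ∀ D π i j δ c {Γ L} → FlatVars Γ δ L → Segment L c (labelsR D π i j) → Γ ⊢* generics D π i j δ c ∶ D
  generics-⊢ p π i j δ c fv seg = []
  generics-⊢ (E ⊸ D) π i j δ c {Γ} {L} fv seg =
    generic-⊢ E ((i , j) ∷ π) δ c fv (Segment-++ˡ seg)
    ∷ generics-⊢ D π i (suc j) δ (c + countG E) fv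
        (≡.subst (λ n → Segment L (c + n) (labelsR D π i (suc j))) (length-labelsG E _) (Segment-++ʳ seg))

window : ℕ → ℕ → ℕ → ℕ
window zero zero x = 0
window zero (suc m) zero = 1
window zero (suc m) (suc x) = window zero m x
window (suc a) m zero = 0
window (suc a) m (suc x) = window a m x

window-shift : ∀ k a m x → window (k + a) m (k + x) ≡ window a m x
window-shift zero a m x = refl
window-shift (suc k) a m x = window-shift k a m x

window-split : ∀ a m m′ x → window a m x + window (a + m) m′ x ≡ window a (m + m′) x
window-split zero zero m′ x = refl
window-split zero (suc m) m′ zero = refl
window-split zero (suc m) m′ (suc x) = window-split zero m m′ x
window-split (suc a) m m′ zero = refl
window-split (suc a) m m′ (suc x) = window-split a m m′ x

window-empty : ∀ a x → window a 0 x ≡ 0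
window-empty zero x = refl
window-empty (suc a) zero = refl
window-empty (suc a) (suc x) = window-empty a x

window-below : ∀ {a m x} → x < a → window a m x ≡ 0
window-below {suc a} {m} {zero} _ = refl
window-below {suc a} {m} {suc x} (s≤s x<a) = window-below x<a

window-inside : ∀ {m x} → x < m → window 0 m x ≡ 1
window-inside {suc m} {zero} _ = refl
window-inside {suc m} {suc x} (s≤s x<m) = window-inside x<m

window-above : ∀ m x → window 0 m (m + x) ≡ 0
window-above zero x = window-empty 0 x
window-above (suc m) x = window-above m x

window-end : ∀ m → window 0 m m ≡ 0
window-end zero = refl
window-end (suc m) = window-end m

occ-var-window : ∀ a x → occ x (var a) ≡ window a 1 x
occ-var-window zero zero = refl
occ-var-window zero (suc x) = refl
occ-var-window (suc a) zero = refl
occ-var-window (suc a) (suc x) = occ-var-window a x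

private
  interchange : ∀ a b c d → (a + b) + (c + d) ≡ (c + a) + (b + d)
  interchange = solve-∀

mutual
  occ-generic : ∀ T π δ c x → occ x (generic T π δ c) ≡ window (δ + c) (countG T) x
  occ-generic T π δ c x = begin
    occ x (lams k (apps (var (k + δ + c)) args))
      ≡⟨ occ-lams k x _ ⟩
    occ (k + x) (apps (var (k + δ + c)) args)
      ≡⟨ occ-apps (k + x) (var (k + δ + c)) args ⟩
    occ (k + x) (var (k + δ + c)) + occs (k + x) args
      ≡⟨ cong₂ _+_ (occ-var-window (k + δ + c) (k + x)) (occ-genericArgs T π (k + δ) (suc c) 0 (k + x)) ⟩
    window (k + δ + c) 1 (k + x) + (window 0 k (k + x) + window (k + δ + suc c) (countA T) (k + x))
      ≡⟨ cong₂ (λ u v → u + (v + window (k + δ + suc c) (countA T) (k + x)))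
               (≡.trans (cong (λ n → window n 1 (k + x)) (+-assoc k δ c)) (window-shift k (δ + c) 1 x))
               (window-above k x) ⟩
    window (δ + c) 1 x + window (k + δ + suc c) (countA T) (k + x)
      ≡⟨ cong (window (δ + c) 1 x +_) shifted ⟩
    window (δ + c) 1 x + window (δ + c + 1) (countA T) x
      ≡⟨ window-split (δ + c) 1 (countA T) x ⟩
    window (δ + c) (countG T) x ∎
    where
    open ≡.≡-Reasoning
    k = arity T
    args = genericArgs T π (k + δ) (suc c) 0
    shifted : window (k + δ + suc c) (countA T) (k + x) ≡ window (δ + c + 1) (countA T) x
    shifted rewrite +-assoc k δ (suc c) | window-shift k (δ + suc c) (countA T) x | +-suc δ c | +-comm (δ + c) 1 = refl

  occ-genericArgs : ∀ T π δ c i x → occs x (genericArgs T π δ c i) ≡ window 0 (arity T) x + window (δ + c) (countA T) x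
  occ-genericArgs p π δ c i x rewrite window-empty 0 x | window-empty (δ + c) x = refl
  occ-genericArgs (D ⊸ T) π δ c i x = begin
    occ x (apps (var k) gs) + occs x rest
      ≡⟨ cong (_+ occs x rest) (occ-apps x (var k) gs) ⟩
    (occ x (var k) + occs x gs) + occs x rest
      ≡⟨ cong₂ _+_ (cong₂ _+_ (occ-var-window k x) (occ-generics D π i 0 δ c x))
                   (occ-genericArgs T π δ (c + countR D) (suc i) x) ⟩
    (window k 1 x + window (δ + c) (countR D) x) + (window 0 k x + window (δ + (c + countR D)) (countA T) x)
      ≡⟨ interchange (window k 1 x) (window (δ + c) (countR D) x) (window 0 k x) (window (δ + (c + countR D)) (countA T) x) ⟩
    (window 0 k x + window k 1 x) + (window (δ + c) (countR D) x + window (δ + (c + countR D)) (countA T) x)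
      ≡⟨ cong₂ _+_ (≡.trans (window-split 0 k 1 x) (cong (λ n → window 0 n x) (+-comm k 1)))
                   (≡.trans (cong (λ n → window (δ + c) (countR D) x + window n (countA T) x) (≡.sym (+-assoc δ c (countR D))))
                            (window-split (δ + c) (countR D) (countA T) x)) ⟩
    window 0 (suc k) x + window (δ + c) (countR D + countA T) x             ∎
    where
    open ≡.≡-Reasoning
    k = arity T
    gs = generics D π i 0 δ c
    rest = genericArgs T π δ (c + countR D) (suc i)

  occ-generics : ∀ D π i j δ c x → occs x (generics D π i j δ c) ≡ window (δ + c) (countR D) x
  occ-generics p π i j δ c x = ≡.sym (window-empty (δ + c) x)
  occ-generics (E ⊸ D) π i j δ c x = begin
    occ x (generic E ((i , j) ∷ π) δ c) + occs x (generics D π i (suc j) δ (c + countG E))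
      ≡⟨ cong₂ _+_ (occ-generic E ((i , j) ∷ π) δ c x) (occ-generics D π i (suc j) δ (c + countG E) x) ⟩
    window (δ + c) (countG E) x + window (δ + (c + countG E)) (countR D) x
      ≡⟨ cong (λ n → window (δ + c) (countG E) x + window n (countR D) x) (≡.sym (+-assoc δ c (countG E))) ⟩
    window (δ + c) (countG E) x + window (δ + c + countG E) (countR D) x
      ≡⟨ window-split (δ + c) (countG E) (countR D) x ⟩
    window (δ + c) (countR (E ⊸ D)) x ∎
    where open ≡.≡-Reasoning

mutual
  Linear-generic : ∀ T π δ c → Linear (generic T π δ c)
  Linear-generic T π δ c = Linear-lams k once (Linear-apps var (Linear-genericArgs T π (k + δ) (suc c) 0))
    where
    k = arity T
    once : ∀ v → v < k → occ v (apps (var (k + δ + c)) (genericArgs T π (k + δ) (suc c) 0)) ≡ 1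
    once v v<k rewrite occ-apps v (var (k + δ + c)) (genericArgs T π (k + δ) (suc c) 0)
                     | occ-var-window (k + δ + c) v | occ-genericArgs T π (k + δ) (suc c) 0 v
                     | window-below {k + δ + c} {1} (≤-trans v<k (≤-trans (m≤m+n k δ) (m≤m+n (k + δ) c)))
                     | window-inside v<k
                     | window-below {k + δ + suc c} {countA T}
                       (≤-trans v<k (≤-trans (m≤m+n k δ) (m≤m+n (k + δ) (suc c)))) = refl

  Linear-genericArgs : ∀ T π δ c i → All Linear (genericArgs T π δ c i)
  Linear-genericArgs p π δ c i = []
  Linear-genericArgs (D ⊸ T) π δ c i = Linear-apps var (Linear-generics D π i 0 δ c)
    ∷ Linear-genericArgs T π δ (c + countR D) (suc i)

  Linear-generics : ∀ D π i j δ c → All Linear (generics D π i j δ c)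
  Linear-generics p π i j δ c = []
  Linear-generics (E ⊸ D) π i j δ c = Linear-generic E ((i , j) ∷ π) δ c ∷ Linear-generics D π i (suc j) δ (c + countG E)

contextLabels : Ty → List Label
contextLabels A = labelsR A [] 0 0

contextBody : Ty → Tm
contextBody A = apps (var (countR A)) (generics A [] 0 0 0 0)

separatingContext : Ty → Tm
separatingContext A = lams (countR A) (contextBody A)

contextType : Ty → Ty
contextType A = map labelType (contextLabels A) ⊸⋆ p

length-contextTypes : ∀ A → length (map labelType (contextLabels A)) ≡ countR A
length-contextTypes A = ≡.trans (length-map labelType (contextLabels A)) (length-labelsR A [] 0 0)

contextArgs-⊢ : ∀ A → (map labelType (contextLabels A) ++ A ∷ []) ⊢* generics A [] 0 0 0 0 ∶ A
contextArgs-⊢ A = generics-⊢ A [] 0 0 0 0 (λ l → ∋-++ˡ (∋-map l)) (λ l → l)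
  where
  ∋-map : ∀ {L c ℓ} → Lookup L c ℓ → map labelType L ∋ c ∶ labelType ℓ
  ∋-map here = here
  ∋-map (there l) = there (∋-map l)
  ∋-++ˡ : ∀ {Xs Zs n T} → Xs ∋ n ∶ T → (Xs ++ Zs) ∋ n ∶ T
  ∋-++ˡ here = here
  ∋-++ˡ (there x) = there (∋-++ˡ x)

separatingContext-⊢ : ∀ A → (A ∷ []) ⊢ separatingContext A ∶ contextType A
separatingContext-⊢ A = ≡.subst (λ n → (A ∷ []) ⊢ lams n (contextBody A) ∶ contextType A) (length-contextTypes A)
  (lams-⊢ Ys body-⊢)
  where
  Ys = map labelType (contextLabels A)
  body-⊢ : (Ys ++ A ∷ []) ⊢ contextBody A ∶ p
  body-⊢ = apps-⊢ (var (≡.subst (λ n → (Ys ++ A ∷ []) ∋ n ∶ A) (length-contextTypes A) (∋-++-∷ Ys)))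
    (contextArgs-⊢ A)

separatingContext-linear : ∀ A → Linear (separatingContext A)
separatingContext-linear A = Linear-lams (countR A) once (Linear-apps var (Linear-generics A [] 0 0 0 0))
  where
  once : ∀ v → v < countR A → occ v (contextBody A) ≡ 1
  once v v< rewrite occ-apps v (var (countR A)) (generics A [] 0 0 0 0) | occ-var-window (countR A) v
                  | occ-generics A [] 0 0 0 0 v | window-below {countR A} {1} v< | window-inside v< = refl

separatingContext-hole : ∀ A → occ 0 (separatingContext A) ≡ 1
separatingContext-hole A
  rewrite occ-lams (countR A) 0 (contextBody A) | +-identityʳ (countR A)
        | occ-apps (countR A) (var (countR A)) (generics A [] 0 0 0 0) | occ-var≡ (countR A)
        | occ-generics A [] 0 0 0 0 (countR A) | window-end (countR A) = refl

⊸⋆-order : ∀ Ys {T} → All (λ Y → order Y ≤ 2) Ys → order T ≤ 3 → order (Ys ⊸⋆ T) ≤ 3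
⊸⋆-order [] [] T≤3 = T≤3
⊸⋆-order (Y ∷ Ys) (Y≤2 ∷ Ys≤2) T≤3 = ⊸⋆-order Ys Ys≤2 (⊔-lub (s≤s Y≤2) T≤3)

contextType-order : ∀ A → order (contextType A) < 4
contextType-order A = s≤s (⊸⋆-order (map labelType (contextLabels A)) (flat-orders (contextLabels A)) (s≤s z≤n))
  where
  flat-orders : ∀ L → All (λ Y → order Y ≤ 2) (map labelType L)
  flat-orders [] = []
  flat-orders ((_ , k) ∷ L) = flat-order k ∷ flat-orders L

⊢*⇒Scoped : ∀ {Γ us D} → Γ ⊢* us ∶ D → All (Scoped (length Γ)) us
⊢*⇒Scoped [] = []
⊢*⇒Scoped (⊢u ∷ ⊢us) = ⊢⇒Scoped ⊢u ∷ ⊢*⇒Scoped ⊢us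

-- Böhm-out through encoded observation trees

ctrue cfalse : Tm
ctrue = lam (lam (var 1))
cfalse = lam (lam (var 0))

ctrue-closed : Closed ctrue
ctrue-closed = lam (lam (var (s≤s (s≤s z≤n))))

cfalse-closed : Closed cfalse
cfalse-closed = lam (lam (var (s≤s z≤n)))

ctrue-β : ∀ {a b} → Closed a → app (app ctrue a) b =βη a
ctrue-β {a} {b} ca = begin
  app (app ctrue a) b
    ≈⟨ app β refl ⟩
  app (lam (subst 1 (shift 0 a) (var 1))) b
    ≡⟨ cong (λ t → app (lam t) b) (subst-var≡ {1}) ⟩
  app (lam (shift 0 a)) b
    ≡⟨ cong (λ t → app (lam t) b) (shift-closed ca) ⟩
  app (lam a) b
    ≈⟨ β ⟩
  subst 0 b a
    ≡⟨ subst-closed ca ⟩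
  a ∎
  where open βη-Reasoning

cfalse-β : ∀ {a b} → app (app cfalse a) b =βη b
cfalse-β = trans (app β refl) β

module Encoding (ℓ* : Label) where

  tag : Label → Tm
  tag ℓ with ℓ ≟ˡ ℓ*
  ... | yes _ = ctrue
  ... | no _ = cfalse

  tag-target : tag ℓ* ≡ ctrue
  tag-target with ℓ* ≟ˡ ℓ*
  ... | yes _ = refl
  ... | no ℓ*≢ℓ* = ⊥-elim (ℓ*≢ℓ* refl)

  tag-other : ∀ {ℓ} → ℓ ≢ ℓ* → tag ℓ ≡ cfalse
  tag-other {ℓ} ℓ≢ℓ* with ℓ ≟ˡ ℓ*
  ... | yes ℓ≡ℓ* = ⊥-elim (ℓ≢ℓ* ℓ≡ℓ*)
  ... | no _ = refl

  tag-closed : ∀ ℓ → Closed (tag ℓ)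
  tag-closed ℓ with ℓ ≟ˡ ℓ*
  ... | yes _ = ctrue-closed
  ... | no _ = cfalse-closed

  -- Church pair of the tag of the label and the tuple of the children
  encodeNode : Label → List Tm → Tm
  encodeNode ℓ bs = lam (app (app (var 0) (tag ℓ)) (lam (apps (var 0) bs)))

  encodeNode-Scoped : ∀ {k} ℓ {bs} → All (Scoped (suc (suc k))) bs → Scoped k (encodeNode ℓ bs)
  encodeNode-Scoped ℓ sbs = lam (app (app (var (s≤s z≤n)) (Closed⇒Scoped (tag-closed ℓ)))
    (lam (Scoped-apps (var (s≤s z≤n)) sbs)))

  encodeNode-cong : ∀ ℓ {bs bs′} → Pointwise _=βη_ bs bs′ → encodeNode ℓ bs =βη encodeNode ℓ bs′
  encodeNode-cong ℓ bs=bs′ = lam (app refl (lam (apps-cong refl bs=bs′)))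

  mutual
    encode : Tree → Tm
    encode (node π cs) = encodeNode (π , length cs) (encodeAll cs)

    encodeAll : List Tree → List Tm
    encodeAll [] = []
    encodeAll (c ∷ cs) = encode c ∷ encodeAll cs

  mutual
    encode-closed : ∀ T → Closed (encode T)
    encode-closed (node π cs) = encodeNode-Scoped (π , length cs) (All.map Closed⇒Scoped (encodeAll-closed cs))

    encodeAll-closed : ∀ cs → All Closed (encodeAll cs)
    encodeAll-closed [] = []
    encodeAll-closed (c ∷ cs) = encode-closed c ∷ encodeAll-closed cs

  length-encodeAll : ∀ cs → length (encodeAll cs) ≡ length cs
  length-encodeAll [] = refl
  length-encodeAll (c ∷ cs) = cong suc (length-encodeAll cs)

  -- λ x₁ … xₖ. encodeNode (π , k) (x₁ ∷ … ∷ xₖ ∷ []); under the two binders of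
  -- encodeNode, xᵢ is the variable k + 2 − i.
  mkNode : Label → Tm
  mkNode (π , k) = lams k (encodeNode (π , k) (reverse (vars 2 k)))

  mkNode-closed : ∀ ℓ → Closed (mkNode ℓ)
  mkNode-closed (π , k) = Scoped-lams k (encodeNode-Scoped (π , k)
    (≡.subst (λ n → All (Scoped (suc (suc n))) (reverse (vars 2 k))) (≡.sym (+-identityʳ k)) (All-reverse (vars-Scoped 2 k))))

  substs-encodeNode : ∀ {d σ} ℓ xs → All Closed σ → substs d σ (encodeNode ℓ xs)
    ≡ encodeNode ℓ (map (substs (suc (suc d)) σ) xs)
  substs-encodeNode {d} {σ} ℓ xs cσ
    rewrite substs-lam {d} (app (app (var 0) (tag ℓ)) (lam (apps (var 0) xs))) cσ
          | substs-app {suc d} σ (app (var 0) (tag ℓ)) (lam (apps (var 0) xs))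
          | substs-app {suc d} σ (var 0) (tag ℓ)
          | substs-scoped {suc d} {σ} {var 0} (var (s≤s z≤n))
          | substs-scoped {suc d} {σ} (Closed⇒Scoped {suc d} (tag-closed ℓ))
          | substs-lam {suc d} (apps (var 0) xs) cσ
          | substs-apps {suc (suc d)} σ (var 0) xs
          | substs-scoped {suc (suc d)} {σ} {var 0} (var (s≤s z≤n)) = refl

  mkNode-β : ∀ π {k bs} → All Closed bs → length bs ≡ k → apps (mkNode (π , k)) bs =βη encodeNode (π , k) bs
  mkNode-β π {bs = bs} cbs refl = begin
    apps (lams n (encodeNode ℓ (reverse (vars 2 n)))) bs
      ≈⟨ lams-β _ cbs ⟩
    substs 0 (reverse bs) (encodeNode ℓ (reverse (vars 2 n)))
      ≡⟨ substs-encodeNode ℓ (reverse (vars 2 n)) (All-reverse cbs) ⟩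
    encodeNode ℓ (map (substs 2 (reverse bs)) (reverse (vars 2 n)))
      ≡⟨ cong (encodeNode ℓ) (substs-reverse-vars cbs) ⟩
    encodeNode ℓ bs ∎
    where
    open βη-Reasoning
    n = length bs
    ℓ = π , n

  -- reifier π T receives the arguments of a variable of type T bound at π and builds
  -- the node of that variable, each argument being applied to reifiers for its own binders.
  mutual
    reifier : Pos → Ty → Tm
    reifier π T = lams (arity T) (apps (mkNode (π , arity T)) (reifiedArgs T π 0))

    reifiedArgs : Ty → Pos → ℕ → List Tm
    reifiedArgs p π i = []
    reifiedArgs (D ⊸ T) π i = apps (var (arity T)) (reifiers D π i 0) ∷ reifiedArgs T π (suc i)

    reifiers : Ty → Pos → ℕ → ℕ → List Tm
    reifiers p π i j = []
    reifiers (E ⊸ D) π i j = reifier ((i , j) ∷ π) E ∷ reifiers D π i (suc j)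

  applyReifiers : Ty → Pos → ℕ → List Tm → List Tm
  applyReifiers T π i [] = []
  applyReifiers p π i (a ∷ as) = []
  applyReifiers (D ⊸ T) π i (a ∷ as) = apps a (reifiers D π i 0) ∷ applyReifiers T π (suc i) as

  mutual
    reifier-closed : ∀ π T → Closed (reifier π T)
    reifier-closed π T = Scoped-lams (arity T) (Scoped-apps (Closed⇒Scoped (mkNode-closed _))
      (≡.subst (λ k → All (Scoped k) (reifiedArgs T π 0)) (≡.sym (+-identityʳ (arity T))) (reifiedArgs-Scoped T π 0 ≤-refl)))

    reifiedArgs-Scoped : ∀ T π i {k} → arity T ≤ k → All (Scoped k) (reifiedArgs T π i)
    reifiedArgs-Scoped p π i _ = []
    reifiedArgs-Scoped (D ⊸ T) π i T<k =
      Scoped-apps (var T<k) (All.map Closed⇒Scoped (reifiers-closed D π i 0))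
      ∷ reifiedArgs-Scoped T π (suc i) (≤-trans (n≤1+n _) T<k)

    reifiers-closed : ∀ D π i j → All Closed (reifiers D π i j)
    reifiers-closed p π i j = []
    reifiers-closed (E ⊸ D) π i j = reifier-closed ((i , j) ∷ π) E ∷ reifiers-closed D π i (suc j)

  length-applyReifiers : ∀ T π i as → length as ≡ arity T → length (applyReifiers T π i as) ≡ arity T
  length-applyReifiers p π i [] _ = refl
  length-applyReifiers (D ⊸ T) π i (a ∷ as) len≡ = cong suc (length-applyReifiers T π (suc i) as (cong pred len≡))

  applyReifiers-closed : ∀ T π i {as} → All Closed as → All Closed (applyReifiers T π i as)
  applyReifiers-closed T π i [] = []
  applyReifiers-closed p π i (_ ∷ _) = []
  applyReifiers-closed (D ⊸ T) π i (ca ∷ cas) = Scoped-apps ca (reifiers-closed D π i 0) ∷ applyReifiers-closed T π (suc i) cas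

  substs-reifiedArgs : ∀ T π i {as τ} → All Closed as → All Closed τ → length as ≡ arity T
                     → map (substs 0 (reverse as ++ τ)) (reifiedArgs T π i) ≡ applyReifiers T π i as
  substs-reifiedArgs p π i [] _ _ = refl
  substs-reifiedArgs (D ⊸ T) π i {a ∷ as} {τ} (ca ∷ cas) cτ len≡
    rewrite unfold-reverse a as | ++-assoc (reverse as) [ a ] τ
      = cong₂ _∷_ head (substs-reifiedArgs T π (suc i) cas (ca ∷ cτ) (cong pred len≡))
    where
    cσ : All Closed (reverse as ++ a ∷ τ)
    cσ = ++⁺ (All-reverse cas) (ca ∷ cτ)
    a-at : Lookup (reverse as ++ a ∷ τ) (arity T) a
    a-at = ≡.subst (λ k → Lookup (reverse as ++ a ∷ τ) k a) (≡.trans (length-reverse as) (cong pred len≡))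
      (Lookup-++-∷ (reverse as))
    head : substs 0 (reverse as ++ a ∷ τ) (apps (var (arity T)) (reifiers D π i 0)) ≡ apps a (reifiers D π i 0)
    head rewrite substs-apps {0} (reverse as ++ a ∷ τ) (var (arity T)) (reifiers D π i 0)
               | substs-var {0} cσ a-at = cong (apps a) (map-substs-closed {0} {reverse as ++ a ∷ τ} (reifiers-closed D π i 0))

  reifier-β : ∀ π T {as} → All Closed as → length as ≡ arity T
            → apps (reifier π T) as =βη apps (mkNode (π , arity T)) (applyReifiers T π 0 as)
  reifier-β π T {as} cas len≡ = begin
    apps (lams (arity T) X) as                 ≡⟨ cong (λ k → apps (lams k X) as) (≡.sym len≡) ⟩
    apps (lams (length as) X) as               ≈⟨ lams-β X cas ⟩
    substs 0 (reverse as) X                    ≡⟨ substs-apps {0} (reverse as) (mkNode (π , arity T)) (reifiedArgs T π 0) ⟩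
    apps (substs 0 (reverse as) (mkNode (π , arity T))) (map (substs 0 (reverse as)) (reifiedArgs T π 0))
      ≡⟨ cong₂ apps (substs-scoped {0} {reverse as} (mkNode-closed _)) args ⟩
    apps (mkNode (π , arity T)) (applyReifiers T π 0 as) ∎
    where
    open βη-Reasoning
    X = apps (mkNode (π , arity T)) (reifiedArgs T π 0)
    args : map (substs 0 (reverse as)) (reifiedArgs T π 0) ≡ applyReifiers T π 0 as
    args = ≡.subst (λ σ → map (substs 0 σ) (reifiedArgs T π 0) ≡ applyReifiers T π 0 as) (++-identityʳ (reverse as))
             (substs-reifiedArgs T π 0 cas [] len≡)

  env : Scope → List Tm
  env = map (uncurry reifier)

  env-closed : ∀ Δ → All Closed (env Δ)
  env-closed [] = []
  env-closed ((π , T) ∷ Δ) = reifier-closed π T ∷ env-closed Δ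

  env-lookup : ∀ Δ {x T} → types Δ ∋ x ∶ T → Lookup (env Δ) x (reifier (posOf Δ x) T)
  env-lookup (_ ∷ Δ) here = here
  env-lookup (_ ∷ Δ) (there x∈) = there (env-lookup Δ x∈)

  substs-env-closed : ∀ Δ {t} → Scoped (length (types Δ)) t → Closed (substs 0 (env Δ) t)
  substs-env-closed Δ {t} sc =
    substs-Scoped (env-closed Δ) (≡.subst (λ k → Scoped k t) (≡.trans (length-map proj₂ Δ)
      (≡.sym (length-map (uncurry reifier) Δ))) sc)

  mutual
    reify : ∀ Δ π l j {t T} (d : Long (types Δ) t T)
          → apps (substs 0 (env Δ) t) (reifiers T π l j) =βη encode (observe Δ π l j d)
    reify Δ π l j (lam {A = A} {B} {t} d) = begin
      apps (app (substs 0 (env Δ) (lam t)) R) Rs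
        ≡⟨ cong (λ u → apps (app u R) Rs) (substs-lam t (env-closed Δ)) ⟩
      apps (app (lam (substs 1 (env Δ) t)) R) Rs
        ≈⟨ apps-congˡ Rs β ⟩
      apps (substs 0 (env ((((l , j) ∷ π) , A) ∷ Δ)) t) Rs
        ≈⟨ reify _ π l (suc j) d ⟩
      encode (observe Δ π l j (lam d)) ∎
      where
      open βη-Reasoning
      R = reifier ((l , j) ∷ π) A
      Rs = reifiers B π l (suc j)
    reify Δ π l j (ne {x = x} {T = T₀} {us = us} x∈ sp) = begin
      substs 0 (env Δ) (apps (var x) us)
        ≡⟨ substs-apps (env Δ) (var x) us ⟩
      apps (substs 0 (env Δ) (var x)) us′
        ≡⟨ cong (λ h → apps h us′) (substs-var (env-closed Δ) (env-lookup Δ x∈)) ⟩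
      apps (reifier hp T₀) us′
        ≈⟨ reifier-β hp T₀ cus′ length-us′ ⟩
      apps (mkNode (hp , arity T₀)) (applyReifiers T₀ hp 0 us′)
        ≈⟨ mkNode-β hp (applyReifiers-closed T₀ hp 0 cus′) (length-applyReifiers T₀ hp 0 us′ length-us′) ⟩
      encodeNode (hp , arity T₀) (applyReifiers T₀ hp 0 us′)
        ≈⟨ encodeNode-cong _ (reifySpine Δ hp 0 sp) ⟩
      encodeNode (hp , arity T₀) (encodeAll children)
        ≡⟨ cong (λ k → encodeNode (hp , k) (encodeAll children)) (≡.sym (length-observeSpine Δ hp 0 sp)) ⟩
      encode (node hp children) ∎
      where
      open βη-Reasoning
      hp = posOf Δ x
      us′ = map (substs 0 (env Δ)) us
      children = observeSpine Δ hp 0 sp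
      cus′ : All Closed us′
      cus′ = map⁺ (All.map (substs-env-closed Δ) (LongSpine-Scoped sp))
      length-us′ : length us′ ≡ arity T₀
      length-us′ = ≡.trans (length-map _ us) (length-LongSpine sp)

    reifySpine : ∀ Δ hp i {T₀ T us} (sp : LongSpine (types Δ) T₀ T us)
               → Pointwise _=βη_ (applyReifiers T₀ hp i (map (substs 0 (env Δ)) us)) (encodeAll (observeSpine Δ hp i sp))
    reifySpine Δ hp i [] = []
    reifySpine Δ hp i (d ∷ sp) = reify Δ hp i 0 d ∷ reifySpine Δ hp (suc i) sp

  proj : ℕ → ℕ → Tm
  proj i k = lams k (var (k ∸ suc i))

  proj-closed : ∀ {i k} → i < k → Closed (proj i k)
  proj-closed {i} {suc k} _ = Scoped-lams (suc k) (var (s≤s (≤-trans (m∸n≤m k i) (≤-reflexive (≡.sym (+-identityʳ k))))))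

  proj-β : ∀ {i b bs} → All Closed bs → Lookup bs i b → apps (proj i (length bs)) bs =βη b
  proj-β cbs b-at = trans (lams-β _ cbs) (≡⇒βη (substs-var (All-reverse cbs) (Lookup-reverse b-at)))

  select : ℕ → ℕ → Tm
  select i k = lam (lam (app (var 0) (proj i k)))

  selectors : Path → List Tm
  selectors = map (uncurry select)

  encodeNode-β : ∀ ℓ {a bs} → Closed a → All Closed bs
                → app (encodeNode ℓ bs) a =βη app (app a (tag ℓ)) (lam (apps (var 0) bs))
  encodeNode-β ℓ {a} {bs} ca cbs = trans β (≡⇒βη body)
    where
    body : subst 0 a (app (app (var 0) (tag ℓ)) (lam (apps (var 0) bs))) ≡ app (app a (tag ℓ)) (lam (apps (var 0) bs))
    body rewrite subst-closed {0} {a} (tag-closed ℓ) | shift-closed ca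
               | subst-apps 1 a (var 0) bs | subst-var< {1} {0} {a} (s≤s z≤n) | map-subst-closed {1} {a} cbs = refl

  select-child : ∀ {π cs i c} → Lookup cs i c → app (encode (node π cs)) (select i (length cs)) =βη encode c
  select-child {π} {cs} {i} {c} c-at = begin
    app (encodeNode ℓ bs) (select i k)
      ≈⟨ encodeNode-β ℓ (lam (lam (app (var (s≤s z≤n)) (Closed⇒Scoped cP)))) cbs ⟩
    app (app (select i k) (tag ℓ)) W
      ≈⟨ app β refl ⟩
    app (lam (app (var 0) (subst 1 (shift 0 (tag ℓ)) P))) W
      ≡⟨ cong (λ u → app (lam (app (var 0) u)) W) (subst-closed cP) ⟩
    app (lam (app (var 0) P)) W
      ≈⟨ β ⟩
    app W (subst 0 W P)
      ≡⟨ cong (app W) (subst-closed cP) ⟩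
    app W P
      ≈⟨ β ⟩
    subst 0 P (apps (var 0) bs)
      ≡⟨ ≡.trans (subst-apps 0 P (var 0) bs) (cong (apps P) (map-subst-closed cbs)) ⟩
    apps P bs
      ≡⟨ cong (λ n → apps (proj i n) bs) (≡.sym (length-encodeAll cs)) ⟩
    apps (proj i (length bs)) bs
      ≈⟨ proj-β cbs (Lookup-encodeAll c-at) ⟩
    encode c ∎
    where
    open βη-Reasoning
    k = length cs
    ℓ = π , k
    bs = encodeAll cs
    cbs = encodeAll-closed cs
    P = proj i k
    W = lam (apps (var 0) bs)
    cP : Closed P
    cP = proj-closed (Lookup⇒< c-at)
    Lookup-encodeAll : ∀ {cs i c} → Lookup cs i c → Lookup (encodeAll cs) i (encode c)
    Lookup-encodeAll here = here
    Lookup-encodeAll (there l) = there (Lookup-encodeAll l)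

  navigate : ∀ {T ps S} → SubtreeAt T ps S → apps (encode T) (selectors ps) =βη encode S
  navigate here = refl
  navigate (step {ps = ps} c-at at) = trans (apps-congˡ (selectors ps) (select-child c-at)) (navigate at)

  read-tag : ∀ S → app (encode S) ctrue =βη tag (labelOf S)
  read-tag (node π cs) =
    trans (encodeNode-β (π , length cs) ctrue-closed (encodeAll-closed cs))
          (ctrue-β (tag-closed (π , length cs)))

  mkNodes-closed : ∀ L → All Closed (map mkNode L)
  mkNodes-closed [] = []
  mkNodes-closed (ℓ ∷ L) = mkNode-closed ℓ ∷ mkNodes-closed L

  mutual
    substs-generic : ∀ T π δ c {L} → Segment L c (labelsG T π) → substs δ (map mkNode L) (generic T π δ c) ≡ reifier π T
    substs-generic T π δ c {L} seg = begin
      substs δ σ (lams k (apps (var (k + δ + c)) args))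
        ≡⟨ substs-lams k _ (mkNodes-closed L) ⟩
      lams k (substs (k + δ) σ (apps (var (k + δ + c)) args))
        ≡⟨ cong (lams k) (substs-apps σ (var (k + δ + c)) args) ⟩
      lams k (apps (substs (k + δ) σ (var (k + δ + c))) (map (substs (k + δ) σ) args))
        ≡⟨ cong (lams k) (cong₂ apps (substs-var (mkNodes-closed L) (Lookup-map mkNode (Segment-head seg)))
                                      (substs-genericArgs T π (k + δ) (suc c) 0 (m≤m+n k δ) (Segment-tail seg))) ⟩
      reifier π T                                                              ∎
      where
      open ≡.≡-Reasoning
      k = arity T
      σ = map mkNode L
      args = genericArgs T π (k + δ) (suc c) 0

    substs-genericArgs : ∀ T π δ c i {L} → arity T ≤ δ → Segment L c (labelsA T π i)
                       → map (substs δ (map mkNode L)) (genericArgs T π δ c i) ≡ reifiedArgs T π i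
    substs-genericArgs p π δ c i _ _ = refl
    substs-genericArgs (D ⊸ T) π δ c i {L} T<δ seg = cong₂ _∷_ head
      (substs-genericArgs T π δ (c + countR D) (suc i) (≤-trans (n≤1+n _) T<δ)
        (≡.subst (λ n → Segment L (c + n) (labelsA T π (suc i))) (length-labelsR D π i 0) (Segment-++ʳ seg)))
      where
      head : substs δ (map mkNode L) (apps (var (arity T)) (generics D π i 0 δ c)) ≡ apps (var (arity T)) (reifiers D π i 0)
      head rewrite substs-apps {δ} (map mkNode L) (var (arity T)) (generics D π i 0 δ c)
                 | substs-scoped {δ} {map mkNode L} {var (arity T)} (var T<δ)
                 = cong (apps (var (arity T))) (substs-generics D π i 0 δ c (Segment-++ˡ seg))

    substs-generics : ∀ D π i j δ c {L} → Segment L c (labelsR D π i j)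
                    → map (substs δ (map mkNode L)) (generics D π i j δ c) ≡ reifiers D π i j
    substs-generics p π i j δ c _ = refl
    substs-generics (E ⊸ D) π i j δ c {L} seg =
      cong₂ _∷_ (substs-generic E ((i , j) ∷ π) δ c (Segment-++ˡ seg))
                (substs-generics D π i (suc j) δ (c + countG E)
                  (≡.subst (λ n → Segment L (c + n) (labelsR D π i (suc j))) (length-labelsG E _) (Segment-++ʳ seg)))

  probeArgs : Ty → Path → Tm → Tm → List Tm
  probeArgs A ps a b = reverse (map mkNode (contextLabels A)) ++ selectors ps ++ ctrue ∷ a ∷ b ∷ []

  plug-separatingContext : ∀ A {t} → Closed t → subst 0 t (separatingContext A) ≡ lams (countR A) (apps t (generics A [] 0 0 0 0))
  plug-separatingContext A {t} ct = begin
    subst 0 t (lams n (apps (var n) gs))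
      ≡⟨ subst-lams n 0 _ ct ⟩
    lams n (subst (n + 0) t (apps (var n) gs))
      ≡⟨ cong (λ m → lams n (subst m t (apps (var n) gs))) (+-identityʳ n) ⟩
    lams n (subst n t (apps (var n) gs))
      ≡⟨ cong (lams n) (subst-apps n t (var n) gs) ⟩
    lams n (apps (subst n t (var n)) (map (subst n t) gs))
      ≡⟨ cong (lams n) (cong₂ apps (subst-var≡ {n}) gs-unchanged) ⟩
    lams n (apps t gs) ∎
    where
    open ≡.≡-Reasoning
    n = countR A
    gs = generics A [] 0 0 0 0
    gs-scoped : All (Scoped (suc n)) gs
    gs-scoped = ≡.subst (λ m → All (Scoped m) gs) length≡ (⊢*⇒Scoped (contextArgs-⊢ A))
      where
      length≡ : length (map labelType (contextLabels A) ++ A ∷ []) ≡ suc n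
      length≡ = ≡.trans (length-++ (map labelType (contextLabels A))) (≡.trans (+-comm _ 1) (cong suc (length-contextTypes A)))
    gs-unchanged : map (subst n t) gs ≡ gs
    gs-unchanged = map-subst-unused gs-scoped (≡.trans (occ-generics A [] 0 0 0 0 n) (window-end n))

  probe-reifiers : ∀ A {t} → Closed t
    → apps (subst 0 t (separatingContext A)) (reverse (map mkNode (contextLabels A))) =βη apps t (reifiers A [] 0 0)
  probe-reifiers A {t} ct = begin
    apps (subst 0 t (separatingContext A)) (reverse σ)
      ≡⟨ cong (λ u → apps u (reverse σ)) (plug-separatingContext A ct) ⟩
    apps (lams (countR A) X) (reverse σ)
      ≡⟨ cong (λ n → apps (lams n X) (reverse σ)) (≡.sym length-σ) ⟩
    apps (lams (length (reverse σ)) X) (reverse σ)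
      ≈⟨ lams-β X (All-reverse cσ) ⟩
    substs 0 (reverse (reverse σ)) X
      ≡⟨ cong (λ τ → substs 0 τ X) (reverse-involutive σ) ⟩
    substs 0 σ X
      ≡⟨ substs-apps σ t gs ⟩
    apps (substs 0 σ t) (map (substs 0 σ) gs)
      ≡⟨ cong₂ apps (substs-scoped {0} {σ} ct) (substs-generics A [] 0 0 0 0 (λ l → l)) ⟩
    apps t (reifiers A [] 0 0) ∎
    where
    open βη-Reasoning
    σ = map mkNode (contextLabels A)
    cσ = mkNodes-closed (contextLabels A)
    gs = generics A [] 0 0 0 0
    X = apps t gs
    length-σ : length (reverse σ) ≡ countR A
    length-σ = ≡.trans (length-reverse σ) (≡.trans (length-map mkNode (contextLabels A)) (length-labelsR A [] 0 0))

  probe : ∀ A {t n} (d : Long [] n A) → Closed t → t =βη n → ∀ {ps S} → SubtreeAt (observe [] [] 0 0 d) ps S → ∀ a b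
        → apps (subst 0 t (separatingContext A)) (probeArgs A ps a b) =βη app (app (tag (labelOf S)) a) b
  probe A {t} {n} d ct t=n {ps} {S} at a b = begin
    apps C[t] (Rs ++ selectors ps ++ ctrue ∷ a ∷ b ∷ [])
      ≡⟨ ≡.trans (apps-++ C[t] Rs _) (apps-++ (apps C[t] Rs) (selectors ps) _) ⟩
    app (app (app (apps (apps C[t] Rs) (selectors ps)) ctrue) a) b
      ≈⟨ app (app (app (trans (apps-congˡ (selectors ps) observed) (navigate at)) refl) refl) refl ⟩
    app (app (app (encode S) ctrue) a) b
      ≈⟨ app (app (read-tag S) refl) refl ⟩
    app (app (tag (labelOf S)) a) b ∎
    where
    open βη-Reasoning
    C[t] = subst 0 t (separatingContext A)
    Rs = reverse (map mkNode (contextLabels A))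
    observed : apps C[t] Rs =βη encode (observe [] [] 0 0 d)
    observed = trans (probe-reifiers A ct) (trans (apps-congˡ (reifiers A [] 0 0) t=n) (reify [] [] 0 0 d))

separatingContext-injective : ∀ A {t₁ t₂} → [] ⊢ t₁ ∶ A → Linear t₁ → [] ⊢ t₂ ∶ A → Linear t₂
  → subst 0 t₁ (separatingContext A) =βη subst 0 t₂ (separatingContext A) → t₁ =βη t₂
separatingContext-injective A {t₁} {t₂} ⊢t₁ Lt₁ ⊢t₂ Lt₂ C[t₁]=C[t₂]
  with longNormalise ⊢t₁ Lt₁ | longNormalise ⊢t₂ Lt₂
... | longForm n₁ t₁=n₁ d₁ Ln₁ _ | longForm n₂ t₂=n₂ d₂ Ln₂ _
  with separate (observe [] [] 0 0 d₁) (observe [] [] 0 0 d₂)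
... | inj₁ same = trans t₁=n₁ (trans (≡⇒βη n₁≡n₂) (sym t₂=n₂))
  where
  n₁≡n₂ : n₁ ≡ n₂
  n₁≡n₂ = observe-injective [] [] 0 0 d₁ d₂ (λ ()) (λ _ _ ()) (Observable-closed Ln₁) (Observable-closed Ln₂) same
... | inj₂ (separation ps {S₁} {S₂} at₁ at₂ labels≢) = begin
  t₁
    ≈⟨ sym (ctrue-β (⊢⇒Scoped ⊢t₁)) ⟩
  app (app ctrue t₁) t₂
    ≡⟨ cong (λ b → app (app b t₁) t₂) (≡.sym tag-target) ⟩
  app (app (tag (labelOf S₁)) t₁) t₂
    ≈⟨ sym (probe A d₁ (⊢⇒Scoped ⊢t₁) t₁=n₁ at₁ t₁ t₂) ⟩
  apps (subst 0 t₁ (separatingContext A)) (probeArgs A ps t₁ t₂)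
    ≈⟨ apps-congˡ (probeArgs A ps t₁ t₂) C[t₁]=C[t₂] ⟩
  apps (subst 0 t₂ (separatingContext A)) (probeArgs A ps t₁ t₂)
    ≈⟨ probe A d₂ (⊢⇒Scoped ⊢t₂) t₂=n₂ at₂ t₁ t₂ ⟩
  app (app (tag (labelOf S₂)) t₁) t₂
    ≡⟨ cong (λ b → app (app b t₁) t₂) (tag-other (λ e → labels≢ (≡.sym e))) ⟩
  app (app cfalse t₁) t₂
    ≈⟨ cfalse-β ⟩
  t₂ ∎
  where
  open Encoding (labelOf S₁)
  open βη-Reasoning

separatingContext-Context : ∀ A → Context A (contextType A)
separatingContext-Context A = separatingContext A , separatingContext-⊢ A , separatingContext-linear A , separatingContext-hole A

corollary4p1 : (A : Ty) (Θ₁ Θ₂ : Net A) → 3 < order A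
    → ¬ (proj₁ Θ₁ =βη proj₁ Θ₂)
    → Σ Ty (λ B → Σ (Context A B) (λ C →
        (¬ (plug C Θ₁ =βη plug C Θ₂)) × (order B < 4)))
corollary4p1 A (t₁ , ⊢t₁ , Lt₁) (t₂ , ⊢t₂ , Lt₂) _ t₁≠t₂ =
  contextType A , separatingContext-Context A , plugs-differ , contextType-order A
  where
  plugs-differ : ¬ (subst 0 t₁ (separatingContext A) =βη subst 0 t₂ (separatingContext A))
  plugs-differ C[t₁]=C[t₂] = t₁≠t₂ (separatingContext-injective A ⊢t₁ Lt₁ ⊢t₂ Lt₂ C[t₁]=C[t₂])
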